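{- Let $I\subset\mathbb{N}$, $\overline J\subset\overline{\mathbb{N}}$ be nonempty finite subsets with $\min(I\sqcup\overline J)\in I$ and $\max(I\sqcup\overline J)\in\overline J$, and let $\nu=\nu(I,\overline J)$. Then $\rho$ is a bijection from the set of $(I,\overline J)$-trees to the set of $\nu$-Dyck paths. Moreover, for every lattice path $\nu$ (of north and east unit steps) from $(0,0)$ to $(a,b)$ there are disjoint sets $I,J$ with $I\cup J=\{0,1,\dots,a+b+1\}$ such that $\nu(I,\overline J)=\nu$, where $\overline J=\{\overline j: j\in J\}$.
   Context: $\mathbb{N}=\{0,1,\dots\}$, $\overline{\mathbb{N}}$ a disjoint copy, totally ordered by $i\prec\overline i\prec i+1$. An $(I,\overline J)$-forest is a subgraph of the complete bipartite graph $K_{I,\overline J}$ all of whose arcs $(i,\overline j)$ satisfy $i\le j$ and which contains no two arcs $(i,\overline j),(i',\overline{j'})$ with $i<i'\le j<j'$; an $(I,\overline J)$-tree is a maximal $(I,\overline J)$-forest. Lattice paths start at $(0,0)$ and are words in $\mathsf N$ (north) and $\mathsf E$ (east) unit steps. $\nu(I,\overline J)$ is the lattice path from $(0,0)$ to $(|I|-1,|\overline J|-1)$ whose $k$-th step ($1\le k\le |I|+|\overline J|-2$) is $\mathsf E$ if the $(k+1)$-st element of $I\sqcup\overline J$ (listed increasingly w.r.t. $\prec$) lies in $I$, and $\mathsf N$ otherwise. For an $(I,\overline J)$-tree $T$ with $\overline J=\{\overline j_1\prec\dots\prec\overline j_k\}$ and $d_T(\overline j)$ the degree of $\overline j$ in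 $T$, $\rho(T)=\mathsf E^{d_T(\overline j_1)-1}\mathsf N\mathsf E^{d_T(\overline j_2)-1}\mathsf N\cdots\mathsf N\mathsf E^{d_T(\overline j_k)-1}$. For a lattice path $\nu$, a $\nu$-Dyck path is a lattice path with the same endpoint as $\nu$ that lies weakly above $\nu$ (every prefix has at least as many $\mathsf N$ steps as the prefix of $\nu$ of the same length). -}

module Defs where

open import Data.Nat using (ℕ; zero; suc; _+_; _∸_; _≤_; _<_; _≤ᵇ_)
open import Data.Bool using (Bool; true; false; if_then_else_)
open import Data.List using (List; []; _∷_; _++_; length; replicate; map; drop; take; lookup)
open import Data.Fin using (Fin)
open import Data.Vec as V using (Vec)
open import Data.Product using (_×_; Σ; ∃)
open import Data.Empty using (⊥)
open import Relation.Binary.PropositionalEquality using (_≡_)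
open import Relation.Nullary using (¬_)

data Step : Set where
  N E : Step

LatticePath : Set
LatticePath = List Step

countN : LatticePath → ℕ
countN [] = 0
countN (N ∷ p) = suc (countN p)
countN (E ∷ p) = countN p

countE : LatticePath → ℕ
countE [] = 0
countE (E ∷ p) = suc (countE p)
countE (N ∷ p) = countE p

-- A finite subset of ℕ is represented by the strictly increasing list of
-- its elements (Data.List.Relation.Unary.Linked _<_).  A finite subset
-- J̄ of N̄ is represented by the list of the j with j̄ ∈ J̄.

-- Merging I and J̄ in ≺-order (i ≺ j̄ iff i ≤ j, j̄ ≺ i iff j < i);
-- true marks an element of I, false an element of J̄.
mergeTags : List ℕ → List ℕ → List Bool
mergeTags [] js = map (λ _ → false) js
mergeTags (i ∷ is) [] = true ∷ mergeTags is []
mergeTags (i ∷ is) (j ∷ js) =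
  if i ≤ᵇ j then true ∷ mergeTags is (j ∷ js)
            else false ∷ mergeTags (i ∷ is) js

tagStep : Bool → Step
tagStep true = E
tagStep false = N

-- ν(I, J̄): for 1 ≤ k ≤ |I|+|J̄|-2 the k-th step is E iff the (k+1)-st element of I ⊔ J̄ lies in I.
nuPath : List ℕ → List ℕ → LatticePath
nuPath I J = map tagStep (take (length I + length J ∸ 2) (drop 1 (mergeTags I J)))

IsDyck : LatticePath → LatticePath → Set
IsDyck ν π = (countE π ≡ countE ν) × (countN π ≡ countN ν)
  × (∀ k → countN (take k ν) ≤ countN (take k π))

-- A subgraph of K_{I,J̄} (on the full vertex set) is given by its
-- adjacency matrix: row k ↔ k-th element of I, column l ↔ l-th element of J̄.
Graph : List ℕ → List ℕ → Set
Graph I J = Vec (Vec Bool (length J)) (length I)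

arc : ∀ {I J : List ℕ} → Graph I J → Fin (length I) → Fin (length J) → Bool
arc T k l = V.lookup (V.lookup T k) l

IsForest : (I J : List ℕ) → Graph I J → Set
IsForest I J T =
  (∀ k l → arc {I} {J} T k l ≡ true → lookup I k ≤ lookup J l)
  × (∀ k l k' l' → arc {I} {J} T k l ≡ true → arc {I} {J} T k' l' ≡ true →
       ¬ ((lookup I k < lookup I k') × (lookup I k' ≤ lookup J l)
          × (lookup J l < lookup J l')))

SubGraph : (I J : List ℕ) → Graph I J → Graph I J → Set
SubGraph I J T T' = ∀ k l → arc {I} {J} T k l ≡ true → arc {I} {J} T' k l ≡ true

IsTree : (I J : List ℕ) → Graph I J → Set
IsTree I J T = IsForest I J T
  × (∀ T' → IsForest I J T' → SubGraph I J T T' → T' ≡ T)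

degJ : (I J : List ℕ) → Graph I J → Fin (length J) → ℕ
degJ I J T l = V.foldr _ (λ row acc → (if V.lookup row l then 1 else 0) + acc) 0 T

rhoWord : List ℕ → LatticePath
rhoWord [] = []
rhoWord (d ∷ []) = replicate (d ∸ 1) E
rhoWord (d ∷ d' ∷ ds) = replicate (d ∸ 1) E ++ (N ∷ rhoWord (d' ∷ ds))

rho : (I J : List ℕ) → Graph I J → LatticePath
rho I J T = rhoWord (V.toList (V.map (degJ I J T) (V.allFin (length J))))

-- Write I = {i₀ < ⋯ < i_{m-1}}, J̄ = {j̄₀ ≺ ⋯ ≺ j̄_{k-1}} and r b = #{i ∈ I : i ≤ j_b}, so that the
-- arc (a , b) is allowed iff a < r b.  Going through the columns b = 0, 1, … in order, a tree is
-- built from a stack of available rows: the rows below r b not yet available are pushed, column b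
-- takes the top d_b rows of the stack, and all of these but the lowest are popped, because a later
-- arc at such a row would cross.  Maximality forces exactly this shape, so a tree is determined by
-- its degree sequence d, and d occurs iff d_b ≥ 1, Σ_{b′≤b} (d_{b′} - 1) < r b and
-- Σ_b (d_b - 1) = m - 1.  Writing ν = E^{a₀} N E^{a₁} ⋯ N E^{a_{k-1}}, so that Σ_{b′≤b} a_{b′} = r b - 1,
-- and ρ(T) = E^{d₀-1} N ⋯ N E^{d_{k-1}-1}, these are exactly the conditions for ρ(T) to lie weakly
-- above ν with the same endpoint.
--
-- For the second statement, ν = ν(I, J̄) for I = {0} ∪ {t : step t of ν is E} and
-- J = {t : step t of ν is N} ∪ {|ν| + 1}.

module Submission where

open import Defs
open import Data.Nat
  using (ℕ; zero; suc; _+_; _∸_; _≤_; _<_; _>_; _≤ᵇ_; z≤n; s≤s; s≤s⁻¹; pred; _≟_; _≤?_; _<?_)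
open import Data.Nat.Properties
open import Data.Nat.ListAction using (sum)
open import Data.Nat.Induction using (<-rec)
open import Data.Nat.Tactic.RingSolver using (solve-∀)
open import Data.Bool using (Bool; true; false; if_then_else_)
open import Data.Bool.Properties using (T-≡; ⇔→≡)
open import Data.List
  using (List; []; _∷_; _++_; length; replicate; map; take; drop; lookup; applyUpTo; applyDownFrom)
open import Data.List.Properties
  using (++-assoc; ++-identityʳ; length-++; length-map; length-take; length-drop; length-applyUpTo;
         length-applyDownFrom; take++drop≡id; take-all; drop-all; drop-drop; map-∘; map-id)
open import Data.List.Membership.Propositional using (_∈_)
open import Data.List.Membership.Propositional.Properties
  using (∈-++⁺ˡ; ∈-++⁺ʳ; ∈-++⁻; ∈-applyDownFrom⁺; ∈-applyDownFrom⁻)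
open import Data.List.Membership.DecPropositional _≟_ using (_∈?_)
open import Data.List.Relation.Unary.Any using (here; there)
open import Data.List.Relation.Unary.All as All using (All)
open import Data.List.Relation.Unary.AllPairs using (AllPairs; []; _∷_)
import Data.List.Relation.Unary.AllPairs.Properties as AllPairs
open import Data.List.Relation.Unary.Linked using (Linked; []; [-]; _∷_)
open import Data.Fin using (Fin; toℕ; fromℕ<)
open import Data.Fin.Properties using (toℕ-fromℕ<; toℕ<n)
open import Data.Vec as V using (Vec)
open import Data.Vec.Properties using (lookup∘tabulate; tabulate-∘)
open import Data.Product using (_×_; Σ; ∃-syntax; _,_; proj₁; proj₂; map₁; uncurry)
open import Data.Sum using (_⊎_; inj₁; inj₂)
open import Data.Empty using (⊥; ⊥-elim)
open import Function using (_∘_)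
open import Function.Bundles using (_⇔_; mk⇔; Equivalence)
open import Relation.Binary.PropositionalEquality
  using (_≡_; _≢_; refl; sym; trans; cong; cong₂; subst; subst₂; module ≡-Reasoning)
open import Relation.Nullary using (¬_; does; yes; no; contradiction)
open import Relation.Nullary.Decidable using (dec-true; dec-false; does-⇔)

∈-take⁻ : ∀ {a : ℕ} n xs → a ∈ take n xs → a ∈ xs
∈-take⁻ (suc n) (x ∷ xs) (here p) = here p
∈-take⁻ (suc n) (x ∷ xs) (there p) = there (∈-take⁻ n xs p)

∈-drop⁻ : ∀ {a : ℕ} n xs → a ∈ drop n xs → a ∈ xs
∈-drop⁻ zero xs p = p
∈-drop⁻ (suc n) (x ∷ xs) p = there (∈-drop⁻ n xs p)

∈-take-mono : ∀ {a : ℕ} {n n′} xs → n ≤ n′ → a ∈ take n xs → a ∈ take n′ xs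
∈-take-mono (x ∷ xs) (s≤s n≤) (here p) = here p
∈-take-mono (x ∷ xs) (s≤s n≤) (there p) = there (∈-take-mono xs n≤ p)

∈-drop-antimono : ∀ {a : ℕ} {n n′} xs → n ≤ n′ → a ∈ drop n′ xs → a ∈ drop n xs
∈-drop-antimono {n′ = n′} xs z≤n p = ∈-drop⁻ n′ xs p
∈-drop-antimono [] (s≤s n≤) p = p
∈-drop-antimono (x ∷ xs) (s≤s n≤) p = ∈-drop-antimono xs n≤ p

length-take-≤ : ∀ {n} (xs : List ℕ) → n ≤ length xs → length (take n xs) ≡ n
length-take-≤ {n} xs n≤ = trans (length-take n xs) (m≤n⇒m⊓n≡m n≤)

∈-take⊎∈-drop : ∀ {a : ℕ} n xs → a ∈ xs → a ∈ take n xs ⊎ a ∈ drop n xs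
∈-take⊎∈-drop n xs p = ∈-++⁻ (take n xs) (subst (_ ∈_) (sym (take++drop≡id n xs)) p)

Descending : List ℕ → Set
Descending = AllPairs _>_

head-maximum : ∀ {x y : ℕ} {xs} → Descending (x ∷ xs) → y ∈ x ∷ xs → y ≤ x
head-maximum _ (here refl) = ≤-refl
head-maximum (x> ∷ _) (there p) = <⇒≤ (All.lookup x> p)

∈-take-upward : ∀ n {xs} {x c : ℕ} → Descending xs → x ∈ take n xs → c ∈ xs → x < c → c ∈ take n xs
∈-take-upward (suc n) _ _ (here refl) _ = here refl
∈-take-upward (suc n) (x> ∷ _) (here refl) (there q) x<c = ⊥-elim (<-asym x<c (All.lookup x> q))
∈-take-upward (suc n) (_ ∷ desc) (there p) (there q) x<c = there (∈-take-upward n desc p q x<c)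

drop-pred≤take : ∀ n {xs} {a a′ : ℕ} → Descending xs → a′ ∈ take n xs → a ∈ drop (n ∸ 1) xs → a ≤ a′
drop-pred≤take (suc zero) {x ∷ xs} desc (here refl) q = head-maximum desc q
drop-pred≤take (suc (suc n)) {x ∷ xs} (x> ∷ _) (here refl) q = <⇒≤ (All.lookup x> (∈-drop⁻ n xs q))
drop-pred≤take (suc (suc n)) (_ ∷ desc) (there p) q = drop-pred≤take (suc n) desc p q

∃smaller∈take : ∀ n {xs} {a : ℕ} → Descending xs → n ≤ length xs → a ∈ take (n ∸ 1) xs →
  ∃[ s ] (s ∈ take n xs × s < a)
∃smaller∈take (suc (suc n)) {x ∷ y ∷ xs} (x> ∷ _) _ (here refl) = y , there (here refl) , All.lookup x> (here refl)
∃smaller∈take (suc (suc n)) (_ ∷ desc) (s≤s n≤) (there p) with ∃smaller∈take (suc n) desc n≤ p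
... | s , q , s<a = s , there q , s<a

lowest∈take : ∀ n {xs} → Descending xs → 1 ≤ n → n ≤ length xs →
  ∃[ x ] (x ∈ take n xs × x ∈ drop (n ∸ 1) xs × (∀ {c} → c ∈ drop n xs → c < x))
lowest∈take (suc zero) {x ∷ xs} (x> ∷ _) _ _ = x , here refl , here refl , All.lookup x>
lowest∈take (suc (suc n)) (_ ∷ desc) _ (s≤s n≤) with lowest∈take (suc n) desc (s≤s z≤n) n≤
... | y , p , q , below = y , there p , q , below

∉-drop-length : ∀ {c : ℕ} xs → ¬ c ∈ drop (length xs) xs
∉-drop-length (x ∷ xs) p = ∉-drop-length xs p

lengthWhile : (ℕ → Bool) → List ℕ → ℕ
lengthWhile P [] = 0
lengthWhile P (x ∷ xs) = if P x then suc (lengthWhile P xs) else 0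

lengthWhile≤length : ∀ P xs → lengthWhile P xs ≤ length xs
lengthWhile≤length P [] = z≤n
lengthWhile≤length P (x ∷ xs) with P x
... | true = s≤s (lengthWhile≤length P xs)
... | false = z≤n

∈-take-lengthWhile⁻ : ∀ P xs {a} → a ∈ take (lengthWhile P xs) xs → P a ≡ true
∈-take-lengthWhile⁻ P (x ∷ xs) p with P x in eq
∈-take-lengthWhile⁻ P (x ∷ xs) (here refl) | true = eq
∈-take-lengthWhile⁻ P (x ∷ xs) (there p) | true = ∈-take-lengthWhile⁻ P xs p

UpwardClosedIn : (ℕ → Bool) → List ℕ → Set
UpwardClosedIn P xs = ∀ a c → P a ≡ true → c ∈ xs → a < c → P c ≡ true

∈-take-lengthWhile⁺ : ∀ P xs {a} → Descending xs → UpwardClosedIn P xs → P a ≡ true → a ∈ xs →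
  a ∈ take (lengthWhile P xs) xs
∈-take-lengthWhile⁺ P (x ∷ xs) {a} (x> ∷ desc) up Pa p with P x in eq
∈-take-lengthWhile⁺ P (x ∷ xs) {a} (x> ∷ desc) up Pa (here refl) | true = here refl
∈-take-lengthWhile⁺ P (x ∷ xs) {a} (x> ∷ desc) up Pa (there p) | true =
  there (∈-take-lengthWhile⁺ P xs desc (λ a′ c Pa′ q → up a′ c Pa′ (there q)) Pa p)
∈-take-lengthWhile⁺ P (x ∷ xs) {a} (x> ∷ desc) up Pa (here refl) | false with () ← trans (sym Pa) eq
∈-take-lengthWhile⁺ P (x ∷ xs) {a} (x> ∷ desc) up Pa (there p) | false
  with () ← trans (sym (up a x Pa (here refl) (All.lookup x> p))) eq

mem : ℕ → List ℕ → Bool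
mem a xs = does (a ∈? xs)

mem-sound : ∀ a xs → mem a xs ≡ true → a ∈ xs
mem-sound a xs e with a ∈? xs
... | yes p = p

mem-complete : ∀ {a} xs → a ∈ xs → mem a xs ≡ true
mem-complete xs p = dec-true (_ ∈? xs) p

mem-false : ∀ {a} xs → ¬ a ∈ xs → mem a xs ≡ false
mem-false xs ∉ = dec-false (_ ∈? xs) ∉

countBelow : ℕ → (ℕ → Bool) → ℕ
countBelow zero f = 0
countBelow (suc n) f = countBelow n f + (if f n then 1 else 0)

countBelow-suc : ∀ n f → countBelow (suc n) f ≡ (if f 0 then 1 else 0) + countBelow n (λ a → f (suc a))
countBelow-suc zero f = +-comm 0 _
countBelow-suc (suc n) f = trans (cong (_+ (if f (suc n) then 1 else 0)) (countBelow-suc n f))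
  (+-assoc (if f 0 then 1 else 0) _ _)

countBelow-cong : ∀ n {f g : ℕ → Bool} → (∀ a → a < n → f a ≡ g a) → countBelow n f ≡ countBelow n g
countBelow-cong zero f≗g = refl
countBelow-cong (suc n) f≗g =
  cong₂ _+_ (countBelow-cong n (λ a a< → f≗g a (m≤n⇒m≤1+n a<)))
            (cong (λ b → if b then 1 else 0) (f≗g n ≤-refl))

countBelow-mem : ∀ n xs → Descending xs → All (_< n) xs → countBelow n (λ a → mem a xs) ≡ length xs
countBelow-mem zero [] _ _ = refl
countBelow-mem zero (x ∷ xs) _ (() All.∷ _)
countBelow-mem (suc n) [] _ _ = cong (_+ 0) (countBelow-mem n [] [] All.[])
countBelow-mem (suc n) (x ∷ xs) (x> ∷ desc) (x<1+n All.∷ xs<) with x ≟ n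
... | yes refl = trans
  (cong₂ _+_ (trans (countBelow-cong x below) (countBelow-mem x xs desc (All.tabulate (All.lookup x>))))
             (cong (λ b → if b then 1 else 0) (mem-complete (x ∷ xs) (here refl))))
  (+-comm (length xs) 1)
  where
  below : ∀ a → a < x → mem a (x ∷ xs) ≡ mem a xs
  below a a<x = does-⇔ (mk⇔ (λ { (here refl) → ⊥-elim (<-irrefl refl a<x) ; (there p) → p }) there)
    (a ∈? (x ∷ xs)) (a ∈? xs)
... | no x≢n = trans
  (cong₂ _+_ (countBelow-mem n (x ∷ xs) (x> ∷ desc) (All.tabulate <n))
             (cong (λ b → if b then 1 else 0) (mem-false (x ∷ xs) (λ p → <-irrefl refl (<n p)))))
  (+-identityʳ _)
  where
  x<n : x < n
  x<n = ≤∧≢⇒< (s≤s⁻¹ x<1+n) x≢n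
  <n : ∀ {y} → y ∈ x ∷ xs → y < n
  <n p = ≤-<-trans (head-maximum (x> ∷ desc) p) x<n

range : ℕ → ℕ → List ℕ
range lo = applyDownFrom (lo +_)

∈-range⁻ : ∀ lo n {a} → a ∈ range lo n → lo ≤ a × a < lo + n
∈-range⁻ lo n p with ∈-applyDownFrom⁻ (lo +_) p
... | i , i<n , refl = m≤m+n lo i , +-monoʳ-< lo i<n

∈-range⁺ : ∀ lo n {a} → lo ≤ a → a < lo + n → a ∈ range lo n
∈-range⁺ lo n lo≤a a< = subst (_∈ range lo n) (m+[n∸m]≡n lo≤a)
  (∈-applyDownFrom⁺ (lo +_) (+-cancelˡ-< lo _ _ (subst (_< lo + n) (sym (m+[n∸m]≡n lo≤a)) a<)))

range-descending : ∀ lo n → Descending (range lo n)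
range-descending lo zero = []
range-descending lo (suc n) = All.tabulate (λ p → proj₂ (∈-range⁻ lo n p)) ∷ range-descending lo n

length-range : ∀ lo n → length (range lo n) ≡ n
length-range lo = length-applyDownFrom (lo +_)

countBelow-characteristic : ∀ n f xs → Descending xs → All (_< n) xs → (∀ a → f a ≡ true ⇔ a ∈ xs) →
  countBelow n f ≡ length xs
countBelow-characteristic n f xs desc xs<n f⇔∈ = trans
  (countBelow-cong n (λ a _ → ⇔→≡ (mk⇔ (λ fa → mem-complete xs (Equivalence.to (f⇔∈ a) fa))
                                       (λ e → Equivalence.from (f⇔∈ a) (mem-sound a xs e)))))
  (countBelow-mem n xs desc xs<n)

-- Lattice words in blocks

blocks : List ℕ → LatticePath
blocks [] = []
blocks (a ∷ []) = replicate a E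
blocks (a ∷ b ∷ as) = replicate a E ++ N ∷ blocks (b ∷ as)

rhoWord≡blocks : ∀ ds → rhoWord ds ≡ blocks (map (_∸ 1) ds)
rhoWord≡blocks [] = refl
rhoWord≡blocks (d ∷ []) = refl
rhoWord≡blocks (d ∷ d′ ∷ ds) = cong (λ w → replicate (d ∸ 1) E ++ N ∷ w) (rhoWord≡blocks (d′ ∷ ds))

countN-replicateE : ∀ a → countN (replicate a E) ≡ 0
countN-replicateE zero = refl
countN-replicateE (suc a) = countN-replicateE a

countE-replicateE : ∀ a → countE (replicate a E) ≡ a
countE-replicateE zero = refl
countE-replicateE (suc a) = cong suc (countE-replicateE a)

countN-replicateE-++ : ∀ a w → countN (replicate a E ++ w) ≡ countN w
countN-replicateE-++ zero w = refl
countN-replicateE-++ (suc a) w = countN-replicateE-++ a w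

countE-replicateE-++ : ∀ a w → countE (replicate a E ++ w) ≡ a + countE w
countE-replicateE-++ zero w = refl
countE-replicateE-++ (suc a) w = cong suc (countE-replicateE-++ a w)

countN-blocks : ∀ as → countN (blocks as) ≡ pred (length as)
countN-blocks [] = refl
countN-blocks (a ∷ []) = countN-replicateE a
countN-blocks (a ∷ b ∷ as) = trans (countN-replicateE-++ a _) (cong suc (countN-blocks (b ∷ as)))

countE-blocks : ∀ as → countE (blocks as) ≡ sum as
countE-blocks [] = refl
countE-blocks (a ∷ []) = trans (countE-replicateE a) (sym (+-identityʳ a))
countE-blocks (a ∷ b ∷ as) = trans (countE-replicateE-++ a _) (cong (a +_) (countE-blocks (b ∷ as)))

countN-take≤countN : ∀ n w → countN (take n w) ≤ countN w
countN-take≤countN zero w = z≤n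
countN-take≤countN (suc n) [] = z≤n
countN-take≤countN (suc n) (N ∷ w) = s≤s (countN-take≤countN n w)
countN-take≤countN (suc n) (E ∷ w) = countN-take≤countN n w

countN-take-replicateE-N⁻ : ∀ a n t w → suc t ≤ countN (take n (replicate a E ++ N ∷ w)) →
  ∃[ q ] (n ≡ a + suc q × t ≤ countN (take q w))
countN-take-replicateE-N⁻ zero (suc q) t w (s≤s t≤) = q , refl , t≤
countN-take-replicateE-N⁻ (suc a) (suc n) t w t≤ with countN-take-replicateE-N⁻ a n t w t≤
... | q , refl , t≤′ = q , refl , t≤′

countN-take-replicateE-N⁺ : ∀ a q t w → t ≤ countN (take q w) →
  suc t ≤ countN (take (a + suc q) (replicate a E ++ N ∷ w))
countN-take-replicateE-N⁺ zero q t w t≤ = s≤s t≤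
countN-take-replicateE-N⁺ (suc a) q t w t≤ = countN-take-replicateE-N⁺ a q t w t≤

private
  suc-+-swap : ∀ t a s → suc t + (a + s) ≡ a + suc (t + s)
  suc-+-swap = solve-∀

-- The t-th north step of blocks as is its (t + Σ_{s<t} aₛ)-th step.
≤countN-take-blocks⇒ : ∀ as t n → t < length as → t ≤ countN (take n (blocks as)) →
  t + sum (take t as) ≤ n
≤countN-take-blocks⇒ as zero n _ _ = z≤n
≤countN-take-blocks⇒ (a ∷ b ∷ as) (suc t) n (s≤s t<) t≤
  with countN-take-replicateE-N⁻ a n t (blocks (b ∷ as)) t≤
... | q , refl , t≤′ = ≤-trans (≤-reflexive (suc-+-swap t a _))
  (+-monoʳ-≤ a (s≤s (≤countN-take-blocks⇒ (b ∷ as) t q t< t≤′)))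

≤countN-take-blocks⇐ : ∀ as t n → t < length as → t + sum (take t as) ≤ n →
  t ≤ countN (take n (blocks as))
≤countN-take-blocks⇐ as zero n _ _ = z≤n
≤countN-take-blocks⇐ (a ∷ b ∷ as) (suc t) n (s≤s t<) ≤n
  with m≤n⇒∃[o]m+o≡n (m+n≤o⇒m≤o a (m+n≤o⇒n≤o (suc t) ≤n))
... | o , refl with +-cancelˡ-≤ a _ o (subst (_≤ a + o) (suc-+-swap t a _) ≤n)
... | s≤s ≤q = countN-take-replicateE-N⁺ a _ t _ (≤countN-take-blocks⇐ (b ∷ as) t _ t< ≤q)

PrefixSums≤ : List ℕ → List ℕ → Set
PrefixSums≤ ps as = ∀ t → t < length as → sum (take t ps) ≤ sum (take t as)

blocks-dyck⇒ : ∀ as ps → length as ≡ length ps → IsDyck (blocks as) (blocks ps) →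
  PrefixSums≤ ps as × sum ps ≡ sum as
blocks-dyck⇒ as ps len (sameE , _ , above) =
  prefix≤ , trans (sym (countE-blocks ps)) (trans sameE (countE-blocks as))
  where
  prefix≤ : PrefixSums≤ ps as
  prefix≤ t t< = +-cancelˡ-≤ t _ _ (≤countN-take-blocks⇒ ps t _ (subst (t <_) len t<)
    (≤-trans (≤countN-take-blocks⇐ as t _ t< ≤-refl) (above (t + sum (take t as)))))

blocks-dyck⇐ : ∀ as ps → length as ≡ length ps → PrefixSums≤ ps as → sum ps ≡ sum as →
  IsDyck (blocks as) (blocks ps)
blocks-dyck⇐ [] [] _ _ _ = refl , refl , λ _ → ≤-refl
blocks-dyck⇐ (a ∷ as) ps len prefix≤ sum≡ =
  trans (countE-blocks ps) (trans sum≡ (sym (countE-blocks (a ∷ as)))) ,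
  trans (countN-blocks ps) (trans (cong pred (sym len)) (sym (countN-blocks (a ∷ as)))) ,
  above
  where
  above : ∀ n → countN (take n (blocks (a ∷ as))) ≤ countN (take n (blocks ps))
  above n = ≤countN-take-blocks⇐ ps c n (subst (c <_) len c<)
    (≤-trans (+-monoʳ-≤ c (prefix≤ c c<)) (≤countN-take-blocks⇒ (a ∷ as) c n c< ≤-refl))
    where
    c = countN (take n (blocks (a ∷ as)))
    c< : c < length (a ∷ as)
    c< = s≤s (≤-trans (countN-take≤countN n _) (≤-reflexive (countN-blocks (a ∷ as))))

unblocks : LatticePath → ℕ × List ℕ
unblocks [] = 0 , []
unblocks (N ∷ w) = 0 , uncurry _∷_ (unblocks w)
unblocks (E ∷ w) = map₁ suc (unblocks w)

blocks-suc : ∀ a as → blocks (suc a ∷ as) ≡ E ∷ blocks (a ∷ as)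
blocks-suc a [] = refl
blocks-suc a (b ∷ as) = refl

blocks-unblocks : ∀ w → blocks (uncurry _∷_ (unblocks w)) ≡ w
blocks-unblocks [] = refl
blocks-unblocks (N ∷ w) = cong (N ∷_) (blocks-unblocks w)
blocks-unblocks (E ∷ w) = trans (blocks-suc _ (proj₂ (unblocks w))) (cong (E ∷_) (blocks-unblocks w))

unblocks-blocks : ∀ a as → unblocks (blocks (a ∷ as)) ≡ (a , as)
unblocks-blocks zero [] = refl
unblocks-blocks zero (b ∷ as) = cong (λ p → 0 , uncurry _∷_ p) (unblocks-blocks b as)
unblocks-blocks (suc a) as = trans (cong unblocks (blocks-suc a as)) (cong (map₁ suc) (unblocks-blocks a as))

length-unblocks : ∀ w → length (proj₂ (unblocks w)) ≡ countN w
length-unblocks [] = refl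
length-unblocks (N ∷ w) = cong suc (length-unblocks w)
length-unblocks (E ∷ w) = length-unblocks w

blocks-injective : ∀ a as b bs → blocks (a ∷ as) ≡ blocks (b ∷ bs) → a ∷ as ≡ b ∷ bs
blocks-injective a as b bs eq =
  cong (uncurry _∷_) (trans (sym (unblocks-blocks a as)) (trans (cong unblocks eq) (unblocks-blocks b bs)))

-- The stack construction

-- the number of east steps of ρ before its b-th north step, for the degree sequence d
excess : (ℕ → ℕ) → ℕ → ℕ
excess d zero = 0
excess d (suc b) = excess d b + (d b ∸ 1)

excess-suc : ∀ d t → excess d (suc t) ≡ (d 0 ∸ 1) + excess (λ b → d (suc b)) t
excess-suc d zero = +-comm 0 _
excess-suc d (suc t) = trans (cong (_+ (d (suc t) ∸ 1)) (excess-suc d t)) (+-assoc (d 0 ∸ 1) _ _)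

-- Rows a < m, columns b < k = suc k′, and the arc (a , b) is allowed iff a < r b.
module Staircase (m k′ : ℕ) (r : ℕ → ℕ)
  (r-mono : ∀ {b b′} → b ≤ b′ → b′ < suc k′ → r b ≤ r b′)
  (r0>0 : 0 < r 0)
  (r-last : r k′ ≡ m)
  where

  k : ℕ
  k = suc k′

  r≤m : ∀ {b} → b < k → r b ≤ m
  r≤m b<k = ≤-trans (r-mono (s≤s⁻¹ b<k) ≤-refl) (≤-reflexive r-last)

  r>0 : ∀ {b} → b < k → 0 < r b
  r>0 b<k = <-≤-trans r0>0 (r-mono z≤n b<k)

  r-step : ∀ {b} → suc b < k → r b ≤ r (suc b)
  r-step = r-mono (n≤1+n _)

  Admissible : (ℕ → ℕ) → Set
  Admissible d = (∀ b → b < k → 1 ≤ d b) × (∀ b → b < k → excess d (suc b) < r b) × suc (excess d k) ≡ m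

  fresh : ℕ → List ℕ
  fresh b = range (r b) (r (suc b) ∸ r b)

  -- The rows still available to column b, in decreasing order: column b uses the top d b of
  -- them, all of these but the lowest become unavailable, and the rows newly allowed at
  -- column b + 1 are pushed on top.
  stack : (ℕ → ℕ) → ℕ → List ℕ
  stack d zero = range 0 (r 0)
  stack d (suc b) = fresh b ++ drop (d b ∸ 1) (stack d b)

  stack-cong : ∀ {d d′} b → (∀ b′ → b′ < b → d b′ ≡ d′ b′) → stack d b ≡ stack d′ b
  stack-cong zero _ = refl
  stack-cong (suc b) d≗d′ = cong₂ (λ x s → fresh b ++ drop (x ∸ 1) s) (d≗d′ b ≤-refl)
    (stack-cong b (λ b′ b′<b → d≗d′ b′ (m≤n⇒m≤1+n b′<b)))

  ∈-fresh⁻ : ∀ {b a} → suc b < k → a ∈ fresh b → r b ≤ a × a < r (suc b)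
  ∈-fresh⁻ sb<k p with ∈-range⁻ _ _ p
  ... | r≤a , a< = r≤a , subst (_ <_) (m+[n∸m]≡n (r-step sb<k)) a<

  ∈-fresh⁺ : ∀ {b a} → suc b < k → r b ≤ a → a < r (suc b) → a ∈ fresh b
  ∈-fresh⁺ sb<k r≤a a< = ∈-range⁺ _ _ r≤a (subst (_ <_) (sym (m+[n∸m]≡n (r-step sb<k))) a<)

  ∈-stack⇒<r : ∀ d {b a} → b < k → a ∈ stack d b → a < r b
  ∈-stack⇒<r d {zero} _ p = proj₂ (∈-range⁻ 0 (r 0) p)
  ∈-stack⇒<r d {suc b} sb<k p with ∈-++⁻ (fresh b) p
  ... | inj₁ q = proj₂ (∈-fresh⁻ sb<k q)
  ... | inj₂ q = <-≤-trans (∈-stack⇒<r d (<⇒≤ sb<k) (∈-drop⁻ (d b ∸ 1) _ q)) (r-step sb<k)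

  stack-descending : ∀ d {b} → b < k → Descending (stack d b)
  stack-descending d {zero} _ = range-descending 0 (r 0)
  stack-descending d {suc b} sb<k = AllPairs.++⁺
    (range-descending (r b) (r (suc b) ∸ r b))
    (AllPairs.drop⁺ (d b ∸ 1) (stack-descending d b<k))
    (All.tabulate λ p → All.tabulate λ q →
      <-≤-trans (∈-stack⇒<r d b<k (∈-drop⁻ (d b ∸ 1) _ q)) (proj₁ (∈-fresh⁻ sb<k p)))
    where b<k = <⇒≤ sb<k

  length-stack : ∀ d {b} → b < k → (∀ b′ → b′ < b → d b′ ≤ length (stack d b′)) →
    length (stack d b) + excess d b ≡ r b
  length-stack d {zero} _ _ = trans (+-identityʳ _) (length-range 0 (r 0))
  length-stack d {suc b} sb<k d≤ = begin
    length (fresh b ++ drop x (stack d b)) + (excess d b + x)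
      ≡⟨ cong (_+ (excess d b + x)) (trans (length-++ (fresh b))
           (cong₂ _+_ (length-range (r b) (r (suc b) ∸ r b)) (length-drop x (stack d b)))) ⟩
    (r (suc b) ∸ r b) + (L ∸ x) + (excess d b + x)
      ≡⟨ regroup (r (suc b) ∸ r b) (L ∸ x) (excess d b) x ⟩
    (r (suc b) ∸ r b) + ((L ∸ x + x) + excess d b)
      ≡⟨ cong (λ z → (r (suc b) ∸ r b) + (z + excess d b)) (m∸n+n≡m x≤L) ⟩
    (r (suc b) ∸ r b) + (L + excess d b)
      ≡⟨ cong ((r (suc b) ∸ r b) +_) (length-stack d b<k (λ b′ b′<b → d≤ b′ (m≤n⇒m≤1+n b′<b))) ⟩
    (r (suc b) ∸ r b) + r b
      ≡⟨ m∸n+n≡m (r-step sb<k) ⟩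
    r (suc b) ∎
    where
    open ≡-Reasoning
    x L : ℕ
    x = d b ∸ 1
    L = length (stack d b)
    b<k : b < k
    b<k = <⇒≤ sb<k
    x≤L : x ≤ L
    x≤L = ≤-trans (m∸n≤m (d b) 1) (d≤ b ≤-refl)
    regroup : ∀ p q e x → p + q + (e + x) ≡ p + ((q + x) + e)
    regroup = solve-∀

  suc-excess : ∀ d {b} → 1 ≤ d b → suc (excess d (suc b)) ≡ d b + excess d b
  suc-excess d {b} 1≤d with d b
  ... | suc x = cong suc (+-comm (excess d b) x)

  excess-bound⇔ : ∀ d {b} → 1 ≤ d b → length (stack d b) + excess d b ≡ r b →
    excess d (suc b) < r b ⇔ d b ≤ length (stack d b)
  excess-bound⇔ d {b} 1≤d len = mk⇔
    (λ bound → +-cancelʳ-≤ (excess d b) _ _ (subst₂ _≤_ (suc-excess d 1≤d) (sym len) bound))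
    (λ d≤ → subst₂ _≤_ (sym (suc-excess d 1≤d)) len (+-monoˡ-≤ (excess d b) d≤))

  excess-total⇔ : ∀ d → 1 ≤ d k′ → length (stack d k′) + excess d k′ ≡ r k′ →
    suc (excess d k) ≡ m ⇔ d k′ ≡ length (stack d k′)
  excess-total⇔ d 1≤d len = mk⇔
    (λ total → +-cancelʳ-≡ (excess d k′) _ _
                 (trans (sym (suc-excess d 1≤d)) (trans total (trans (sym r-last) (sym len)))))
    (λ d≡ → trans (suc-excess d 1≤d) (trans (cong (_+ excess d k′) d≡) (trans len r-last)))

  Arcs : Set
  Arcs = ℕ → ℕ → Bool

  Allowed : Arcs → Set
  Allowed G = ∀ a b → G a b ≡ true → a < r b

  NonCrossing : Arcs → Set
  NonCrossing G = ∀ a b c d → G a b ≡ true → G c d ≡ true → a < c → c < r b → b < d → ⊥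

  BlockedAbove BlockedBelow : Arcs → ℕ → ℕ → Set
  BlockedAbove G c b = ∃[ x ] ∃[ y ] (G x y ≡ true × c < x × x < r b × b < y)
  BlockedBelow G c b = ∃[ x ] ∃[ y ] (G x y ≡ true × x < c × c < r y × y < b)

  -- maximality in the form a tree yields constructively: an absent allowed arc crosses some arc
  Saturated : Arcs → Set
  Saturated G = ∀ c b → c < r b → b < k → G c b ≡ false →
    ¬ BlockedAbove G c b → ¬ BlockedBelow G c b → ⊥

  module TreeColumns (G : Arcs) (allowed : Allowed G) (column<k : ∀ a b → G a b ≡ true → b < k)
    (noncrossing : NonCrossing G) (saturated : Saturated G) where

    degree : ℕ → ℕ
    degree b = countBelow m (λ a → G a b)

    S : ℕ → List ℕ
    S = stack degree

    -- a is used by an earlier column together with a lower row, so no later arc may use a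
    Hidden : ℕ → ℕ → Set
    Hidden a b = ∃[ b′ ] ∃[ a′ ] (b′ < b × a′ < a × G a′ b′ ≡ true × G a b′ ≡ true)

    record StackInvariant (b : ℕ) : Set where
      field
        sound : ∀ {a} → a ∈ S b → a < r b × ¬ Hidden a b
        complete : ∀ {a} → a < r b → ¬ Hidden a b → a ∈ S b

    record ColumnIsTop (b : ℕ) : Set where
      field
        column⊆top : ∀ {a} → G a b ≡ true → a ∈ take (degree b) (S b)
        top⊆column : ∀ {a} → a ∈ take (degree b) (S b) → G a b ≡ true
        degree≥1 : 1 ≤ degree b
        degree≤length : degree b ≤ length (S b)

    open StackInvariant
    open ColumnIsTop

    stackInvariant-zero : StackInvariant 0
    stackInvariant-zero = record
      { sound = λ p → proj₂ (∈-range⁻ 0 (r 0) p) , λ { (_ , _ , () , _) }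
      ; complete = λ a<r _ → ∈-range⁺ 0 (r 0) z≤n a<r }

    stackInvariant-suc : ∀ {b} → suc b < k → StackInvariant b → ColumnIsTop b → StackInvariant (suc b)
    stackInvariant-suc {b} sb<k inv col = record { sound = sound′ ; complete = complete′ }
      where
      b<k : b < k
      b<k = <⇒≤ sb<k
      desc : Descending (S b)
      desc = stack-descending degree b<k

      sound′ : ∀ {a} → a ∈ S (suc b) → a < r (suc b) × ¬ Hidden a (suc b)
      sound′ {a} p with ∈-++⁻ (fresh b) p
      ... | inj₁ q = proj₂ (∈-fresh⁻ sb<k q) , λ { (b′ , _ , b′<1+b , _ , _ , ab′) →
              <⇒≱ (allowed a b′ ab′) (≤-trans (r-mono (s≤s⁻¹ b′<1+b) b<k) (proj₁ (∈-fresh⁻ sb<k q))) }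
      ... | inj₂ q with sound inv (∈-drop⁻ (degree b ∸ 1) (S b) q)
      ... | a<r , ¬hidden = <-≤-trans a<r (r-step sb<k) , ¬hidden′
        where
        ¬hidden′ : ¬ Hidden a (suc b)
        ¬hidden′ (b′ , a′ , b′<1+b , a′<a , a′b′ , ab′) with m<1+n⇒m<n∨m≡n b′<1+b
        ... | inj₁ b′<b = ¬hidden (b′ , a′ , b′<b , a′<a , a′b′ , ab′)
        ... | inj₂ refl = <⇒≱ a′<a (drop-pred≤take (degree b) desc (column⊆top col a′b′) q)

      complete′ : ∀ {a} → a < r (suc b) → ¬ Hidden a (suc b) → a ∈ S (suc b)
      complete′ {a} a<r ¬hidden with r b ≤? a
      ... | yes r≤a = ∈-++⁺ˡ (∈-fresh⁺ sb<k r≤a a<r)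
      ... | no r≰a with ∈-take⊎∈-drop (degree b ∸ 1) (S b) (complete inv (≰⇒> r≰a)
                          λ { (b′ , a′ , b′<b , h) → ¬hidden (b′ , a′ , m≤n⇒m≤1+n b′<b , h) })
      ... | inj₂ q = ∈-++⁺ʳ (fresh b) q
      ... | inj₁ q with ∃smaller∈take (degree b) desc (degree≤length col) q
      ... | s , s∈ , s<a = ⊥-elim (¬hidden (b , s , n<1+n b , s<a , top⊆column col s∈ ,
                              top⊆column col (∈-take-mono (S b) (m∸n≤m (degree b) 1) q)))

    module Column {b} (b<k : b < k) (inv : StackInvariant b)
      (earlier : ∀ {y} → y < b → StackInvariant y × ColumnIsTop y) where

      desc : Descending (S b)
      desc = stack-descending degree b<k

      arc∈stack : ∀ {a} → G a b ≡ true → a ∈ S b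
      arc∈stack {a} ab = complete inv (allowed a b ab) λ { (b′ , a′ , b′<b , a′<a , a′b′ , ab′) →
        noncrossing a′ b′ a b a′b′ ab a′<a (allowed a b′ ab′) b′<b }

      -- Such an arc (x , y) would put c among the top rows of the stack at y, making c hidden at b.
      ¬blockedBelow : ∀ {c} → c ∈ S b → ¬ BlockedBelow G c b
      ¬blockedBelow {c} c∈ (x , y , xy , x<c , c<ry , y<b) = ¬hidden (y , x , y<b , x<c , xy , cy)
        where
        ¬hidden : ¬ Hidden c b
        ¬hidden = proj₂ (sound inv c∈)
        invʸ : StackInvariant y
        invʸ = proj₁ (earlier y<b)
        colʸ : ColumnIsTop y
        colʸ = proj₂ (earlier y<b)
        c∈Sy : c ∈ S y
        c∈Sy = complete invʸ c<ry λ { (b′ , a′ , b′<y , h) → ¬hidden (b′ , a′ , <-trans b′<y y<b , h) }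
        cy : G c y ≡ true
        cy = top⊆column colʸ (∈-take-upward (degree y) (stack-descending degree (<-trans y<b b<k))
               (column⊆top colʸ xy) c∈Sy x<c)

      upward : UpwardClosedIn (λ a → G a b) (S b)
      upward a c ab c∈ a<c with G c b in cb
      ... | true = refl
      ... | false = ⊥-elim (saturated c b (proj₁ (sound inv c∈)) b<k cb
              (λ { (x , y , xy , c<x , x<rb , b<y) → noncrossing a b x y ab xy (<-trans a<c c<x) x<rb b<y })
              (¬blockedBelow c∈))

      top∈column : ∀ {s ss} → S b ≡ s ∷ ss → G s b ≡ true
      top∈column {s} eq with G s b in sb
      ... | true = refl
      ... | false = ⊥-elim (saturated s b (proj₁ (sound inv s∈)) b<k sb ¬above (¬blockedBelow s∈))
        where
        s∈ : s ∈ S b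
        s∈ = subst (s ∈_) (sym eq) (here refl)
        ¬above : ¬ BlockedAbove G s b
        ¬above (x , y , xy , s<x , x<rb , b<y) = <⇒≱ s<x
          (head-maximum (subst Descending eq desc) (subst (x ∈_) eq (complete inv x<rb
            λ { (b′ , a′ , b′<b , a′<x , a′b′ , xb′) →
                  noncrossing a′ b′ x y a′b′ xy a′<x (allowed x b′ xb′) (<-trans b′<b b<y) })))

      n : ℕ
      n = lengthWhile (λ a → G a b) (S b)

      0∈S : 0 ∈ S b
      0∈S = complete inv (r>0 b<k) λ { (_ , _ , _ , () , _) }

      n≥1 : 1 ≤ n
      n≥1 with S b in eq | 0∈S
      ... | s ∷ ss | _ rewrite top∈column eq = s≤s z≤n

      column⇔top : ∀ a → G a b ≡ true ⇔ a ∈ take n (S b)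
      column⇔top a = mk⇔ (λ ab → ∈-take-lengthWhile⁺ _ (S b) desc upward ab (arc∈stack ab))
                         (∈-take-lengthWhile⁻ _ (S b))

      degree≡n : degree b ≡ n
      degree≡n = trans
        (countBelow-characteristic m _ (take n (S b)) (AllPairs.take⁺ n desc)
          (All.tabulate λ p → <-≤-trans (∈-stack⇒<r degree b<k (∈-take⁻ n (S b) p)) (r≤m b<k))
          column⇔top)
        (length-take-≤ (S b) (lengthWhile≤length _ (S b)))

      columnIsTop : ColumnIsTop b
      columnIsTop = record
        { column⊆top = λ ab → subst (λ z → _ ∈ take z (S b)) (sym degree≡n)
                                 (Equivalence.to (column⇔top _) ab)
        ; top⊆column = λ p → Equivalence.from (column⇔top _) (subst (λ z → _ ∈ take z (S b)) degree≡n p)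
        ; degree≥1 = subst (1 ≤_) (sym degree≡n) n≥1
        ; degree≤length = subst (_≤ length (S b)) (sym degree≡n) (lengthWhile≤length _ (S b)) }

      lastColumn : b ≡ k′ → degree b ≡ length (S b)
      lastColumn b≡k′ = countBelow-characteristic m _ (S b) desc
        (All.tabulate λ p → <-≤-trans (∈-stack⇒<r degree b<k p) (r≤m b<k))
        λ a → mk⇔ arc∈stack (last∈column a)
        where
        last∈column : ∀ a → a ∈ S b → G a b ≡ true
        last∈column a a∈ with G a b in ab
        ... | true = refl
        ... | false = ⊥-elim (saturated a b (proj₁ (sound inv a∈)) b<k ab
                (λ { (x , y , xy , _ , _ , b<y) → <⇒≱ (column<k x y xy) (subst (_< y) b≡k′ b<y) })
                (¬blockedBelow a∈))

    invariants : ∀ b → b < k → StackInvariant b × ColumnIsTop b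
    invariants = <-rec (λ b → b < k → StackInvariant b × ColumnIsTop b) λ b ih b<k →
      let earlier : ∀ {y} → y < b → StackInvariant y × ColumnIsTop y
          earlier y<b = ih y<b (<-trans y<b b<k)
          inv = invariant b b<k earlier
      in inv , Column.columnIsTop b<k inv earlier
      where
      invariant : ∀ b → b < k → (∀ {y} → y < b → StackInvariant y × ColumnIsTop y) → StackInvariant b
      invariant zero _ _ = stackInvariant-zero
      invariant (suc b) sb<k earlier = uncurry (stackInvariant-suc sb<k) (earlier ≤-refl)

    column : ∀ {b} → b < k → ColumnIsTop b
    column b<k = proj₂ (invariants _ b<k)

    length-S : ∀ {b} → b < k → length (S b) + excess degree b ≡ r b
    length-S b<k = length-stack degree b<k λ b′ b′<b → degree≤length (column (<-trans b′<b b<k))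

    degree-admissible : Admissible degree
    degree-admissible =
      (λ b b<k → degree≥1 (column b<k)) ,
      (λ b b<k → Equivalence.from (excess-bound⇔ degree (degree≥1 (column b<k)) (length-S b<k))
                   (degree≤length (column b<k))) ,
      Equivalence.from (excess-total⇔ degree (degree≥1 (column ≤-refl)) (length-S ≤-refl))
        (Column.lastColumn ≤-refl (proj₁ (invariants k′ ≤-refl))
          (λ y<k′ → invariants _ (<-trans y<k′ ≤-refl)) refl)

    G≡top : ∀ {b} → b < k → ∀ a → G a b ≡ mem a (take (degree b) (S b))
    G≡top b<k a = ⇔→≡ (mk⇔ (λ ab → mem-complete _ (column⊆top (column b<k) ab))
                          (λ e → top⊆column (column b<k) (mem-sound a _ e)))

  module FromAdmissible (d : ℕ → ℕ) (admissible : Admissible d) where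

    d≥1 : ∀ b → b < k → 1 ≤ d b
    d≥1 = proj₁ admissible

    bound : ∀ b → b < k → excess d (suc b) < r b
    bound = proj₁ (proj₂ admissible)

    total : suc (excess d k) ≡ m
    total = proj₂ (proj₂ admissible)

    S : ℕ → List ℕ
    S = stack d

    desc : ∀ {b} → b < k → Descending (S b)
    desc = stack-descending d

    d≤length : ∀ b → b < k → d b ≤ length (S b)
    d≤length = <-rec (λ b → b < k → d b ≤ length (S b)) λ b ih b<k →
      Equivalence.to (excess-bound⇔ d (d≥1 b b<k) (length-stack d b<k λ b′ b′<b → ih b′<b (<-trans b′<b b<k)))
        (bound b b<k)

    last-full : d k′ ≡ length (S k′)
    last-full = Equivalence.to
      (excess-total⇔ d (d≥1 k′ ≤-refl) (length-stack d ≤-refl λ b′ b′<k′ → d≤length b′ (<-trans b′<k′ ≤-refl)))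
      total

    G : Arcs
    G a b with b <? k
    ... | yes _ = mem a (take (d b) (S b))
    ... | no _ = false

    G-true⁻ : ∀ {a b} → G a b ≡ true → b < k × a ∈ take (d b) (S b)
    G-true⁻ {a} {b} e with b <? k
    ... | yes b<k = b<k , mem-sound a _ e

    G≡top : ∀ {a b} → b < k → G a b ≡ mem a (take (d b) (S b))
    G≡top {b = b} b<k with b <? k
    ... | yes _ = refl
    ... | no b≮k = ⊥-elim (b≮k b<k)

    G-true⁺ : ∀ {a b} → b < k → a ∈ take (d b) (S b) → G a b ≡ true
    G-true⁺ b<k p = trans (G≡top b<k) (mem-complete _ p)

    allowed : Allowed G
    allowed a b ab with G-true⁻ ab
    ... | b<k , a∈ = ∈-stack⇒<r d b<k (∈-take⁻ (d b) (S b) a∈)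

    column<k : ∀ a b → G a b ≡ true → b < k
    column<k a b ab = proj₁ (G-true⁻ ab)

    survives : ∀ {y b c} → y < k → c ∈ S y → c < r b → b < y → c ∈ drop (d b ∸ 1) (S b)
    survives {suc y} sy<k c∈ c<rb b<sy with ∈-++⁻ (fresh y) c∈
    ... | inj₁ q = ⊥-elim (<⇒≱ c<rb (≤-trans (r-mono (s≤s⁻¹ b<sy) (<⇒≤ sy<k))
                                               (proj₁ (∈-fresh⁻ sy<k q))))
    ... | inj₂ q with m<1+n⇒m<n∨m≡n b<sy
    ... | inj₂ refl = q
    ... | inj₁ b<y = survives (<⇒≤ sy<k) (∈-drop⁻ (d y ∸ 1) (S y) q) c<rb b<y

    noncrossing : NonCrossing G
    noncrossing a b c y ab cy a<c c<rb b<y with G-true⁻ ab | G-true⁻ cy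
    ... | b<k , a∈ | y<k , c∈ =
      <⇒≱ a<c (drop-pred≤take (d b) (desc b<k) a∈ (survives y<k (∈-take⁻ (d y) (S y) c∈) c<rb b<y))

    degree-G : ∀ {b} → b < k → countBelow m (λ a → G a b) ≡ d b
    degree-G {b} b<k = trans
      (countBelow-characteristic m _ (take (d b) (S b)) (AllPairs.take⁺ (d b) (desc b<k))
        (All.tabulate λ p → <-≤-trans (∈-stack⇒<r d b<k (∈-take⁻ (d b) (S b) p)) (r≤m b<k))
        λ a → mk⇔ (λ ab → mem-sound a _ (trans (sym (G≡top b<k)) ab)) (G-true⁺ b<k))
      (length-take-≤ (S b) (d≤length b b<k))

    -- the last column takes its whole stack
    eventually-used : ∀ {y x} → y < k → x ∈ S y → ∃[ y′ ] (y ≤ y′ × y′ < k × x ∈ take (d y′) (S y′))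
    eventually-used {y} y<k = go (k′ ∸ y) (m∸n+n≡m (s≤s⁻¹ y<k))
      where
      go : ∀ {y x} t → t + y ≡ k′ → x ∈ S y → ∃[ y′ ] (y ≤ y′ × y′ < k × x ∈ take (d y′) (S y′))
      go zero refl x∈ =
        k′ , ≤-refl , ≤-refl , subst (_ ∈_) (sym (take-all (d k′) (S k′) (≤-reflexive (sym last-full)))) x∈
      go {y} (suc t) t+y≡ x∈ with ∈-take⊎∈-drop (d y) (S y) x∈
      ... | inj₁ q = y , ≤-refl , s≤s (m+n≤o⇒n≤o (suc t) (≤-reflexive t+y≡)) , q
      ... | inj₂ q
        with go t (trans (+-suc t y) t+y≡) (∈-++⁺ʳ (fresh y) (∈-drop-antimono (S y) (m∸n≤m (d y) 1) q))
      ... | y′ , sy≤y′ , y′<k , q′ = y′ , <⇒≤ sy≤y′ , y′<k , q′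

    blockedBelow-of-∉stack : ∀ {b c} → b < k → c < r b → ¬ c ∈ S b → BlockedBelow G c b
    blockedBelow-of-∉stack {zero} _ c<r c∉ = ⊥-elim (c∉ (∈-range⁺ 0 (r 0) z≤n c<r))
    blockedBelow-of-∉stack {suc b} {c} sb<k c<r c∉ with r b ≤? c | c ∈? S b
    ... | yes r≤c | _ = ⊥-elim (c∉ (∈-++⁺ˡ (∈-fresh⁺ sb<k r≤c c<r)))
    ... | no r≰c | no c∉Sb with blockedBelow-of-∉stack (<⇒≤ sb<k) (≰⇒> r≰c) c∉Sb
    ...   | x , y , xy , x<c , c<ry , y<b = x , y , xy , x<c , c<ry , m≤n⇒m≤1+n y<b
    blockedBelow-of-∉stack {suc b} {c} sb<k c<r c∉ | no r≰c | yes c∈Sb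
      with ∈-take⊎∈-drop (d b ∸ 1) (S b) c∈Sb
    ... | inj₂ q = ⊥-elim (c∉ (∈-++⁺ʳ (fresh b) q))
    ... | inj₁ q with ∃smaller∈take (d b) (desc (<⇒≤ sb<k)) (d≤length b (<⇒≤ sb<k)) q
    ... | s , s∈ , s<c = s , b , G-true⁺ (<⇒≤ sb<k) s∈ , s<c , ≰⇒> r≰c , ≤-refl

    last-exhausted : ∀ {c} → ¬ c ∈ drop (d k′) (S k′)
    last-exhausted = subst (λ z → ¬ _ ∈ drop z (S k′)) (sym last-full) (∉-drop-length (S k′))

    blocked : ∀ c b → c < r b → b < k → G c b ≡ false → BlockedAbove G c b ⊎ BlockedBelow G c b
    blocked c b c<r b<k cb with c ∈? S b
    ... | no c∉ = inj₂ (blockedBelow-of-∉stack b<k c<r c∉)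
    ... | yes c∈ with ∈-take⊎∈-drop (d b) (S b) c∈
    ... | inj₁ q = contradiction (trans (sym cb) (G-true⁺ b<k q)) λ ()
    ... | inj₂ q with b <? k′
    ... | no b≮k′ = ⊥-elim (subst (λ z → ¬ c ∈ drop (d z) (S z)) (sym (≤-antisym (s≤s⁻¹ b<k) (≮⇒≥ b≮k′)))
                      last-exhausted q)
    ... | yes b<k′ with lowest∈take (d b) (desc b<k) (d≥1 b b<k) (d≤length b b<k)
    ... | x , x∈top , x∈rest , below with eventually-used (s≤s b<k′) (∈-++⁺ʳ (fresh b) x∈rest)
    ... | y , sb≤y , y<k , x∈y =
      inj₁ (x , y , G-true⁺ y<k x∈y , below q , ∈-stack⇒<r d b<k (∈-take⁻ (d b) (S b) x∈top) , sb≤y)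

-- nth xs a is the a-th element of xs, with junk value 0 when a ≥ length xs
nth : List ℕ → ℕ → ℕ
nth [] _ = 0
nth (x ∷ xs) zero = x
nth (x ∷ xs) (suc a) = nth xs a

lookup≡nth : ∀ (xs : List ℕ) i → lookup xs i ≡ nth xs (toℕ i)
lookup≡nth (x ∷ xs) Fin.zero = refl
lookup≡nth (x ∷ xs) (Fin.suc i) = lookup≡nth xs i

∈⇒nth : ∀ {x} xs → x ∈ xs → ∃[ a ] (a < length xs × nth xs a ≡ x)
∈⇒nth (y ∷ xs) (here refl) = 0 , s≤s z≤n , refl
∈⇒nth (y ∷ xs) (there p) with ∈⇒nth xs p
... | a , a< , eq = suc a , s≤s a< , eq

linked-tail : ∀ {x} {xs : List ℕ} → Linked _<_ (x ∷ xs) → Linked _<_ xs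
linked-tail [-] = []
linked-tail (_ ∷ l) = l

head<nth : ∀ {x} xs → Linked _<_ (x ∷ xs) → ∀ {a} → a < length xs → x < nth xs a
head<nth (y ∷ xs) (x<y ∷ _) {zero} _ = x<y
head<nth (y ∷ xs) (x<y ∷ l) {suc a} (s≤s a<) = <-trans x<y (head<nth xs l a<)

nth-mono-< : ∀ xs → Linked _<_ xs → ∀ {a b} → a < b → b < length xs → nth xs a < nth xs b
nth-mono-< (x ∷ xs) l {zero} {suc b} _ (s≤s b<) = head<nth xs l b<
nth-mono-< (x ∷ xs) l {suc a} {suc b} (s≤s a<b) (s≤s b<) = nth-mono-< xs (linked-tail l) a<b b<

nth-mono-≤ : ∀ xs → Linked _<_ xs → ∀ {a b} → a ≤ b → b < length xs → nth xs a ≤ nth xs b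
nth-mono-≤ xs l a≤b b< with m≤n⇒m<n∨m≡n a≤b
... | inj₁ a<b = <⇒≤ (nth-mono-< xs l a<b b<)
... | inj₂ refl = ≤-refl

nth-cancel-< : ∀ xs → Linked _<_ xs → ∀ {a b} → a < length xs → nth xs a < nth xs b → a < b
nth-cancel-< xs l {a} {b} a< lt with a <? b
... | yes a<b = a<b
... | no a≮b = ⊥-elim (<⇒≱ lt (nth-mono-≤ xs l (≮⇒≥ a≮b) a<))

-- for a sorted list, rank j xs is the number of its elements that are ≤ j
rank : ℕ → List ℕ → ℕ
rank j = lengthWhile (_≤ᵇ j)

≤⇒≤ᵇ≡true : ∀ {i j} → i ≤ j → (i ≤ᵇ j) ≡ true
≤⇒≤ᵇ≡true i≤j = Equivalence.to T-≡ (≤⇒≤ᵇ i≤j)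

≤ᵇ≡true⇒≤ : ∀ i j → (i ≤ᵇ j) ≡ true → i ≤ j
≤ᵇ≡true⇒≤ i j e = ≤ᵇ⇒≤ i j (Equivalence.from T-≡ e)

<rank⇒nth≤ : ∀ j xs {a} → a < rank j xs → nth xs a ≤ j
<rank⇒nth≤ j (i ∷ is) {a} a< with i ≤ᵇ j in eq
<rank⇒nth≤ j (i ∷ is) {zero} a< | true = ≤ᵇ≡true⇒≤ i j eq
<rank⇒nth≤ j (i ∷ is) {suc a} (s≤s a<) | true = <rank⇒nth≤ j is a<

nth≤⇒<rank : ∀ j xs → Linked _<_ xs → ∀ {a} → a < length xs → nth xs a ≤ j → a < rank j xs
nth≤⇒<rank j (i ∷ is) l {zero} _ i≤j rewrite ≤⇒≤ᵇ≡true i≤j = s≤s z≤n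
nth≤⇒<rank j (i ∷ is) l {suc a} (s≤s a<) ≤j rewrite ≤⇒≤ᵇ≡true (<⇒≤ (<-≤-trans (head<nth is l a<) ≤j)) =
  s≤s (nth≤⇒<rank j is (linked-tail l) a< ≤j)

rank-mono : ∀ {j j′} xs → j ≤ j′ → rank j xs ≤ rank j′ xs
rank-mono [] _ = z≤n
rank-mono {j} {j′} (i ∷ is) j≤j′ with i ≤ᵇ j in eq
... | false = z≤n
... | true rewrite ≤⇒≤ᵇ≡true (≤-trans (≤ᵇ≡true⇒≤ i j eq) j≤j′) = s≤s (rank-mono is j≤j′)

rank-all : ∀ j xs → (∀ {x} → x ∈ xs → x ≤ j) → rank j xs ≡ length xs
rank-all j [] _ = refl
rank-all j (i ∷ is) ≤j rewrite ≤⇒≤ᵇ≡true (≤j (here refl)) = cong suc (rank-all j is (λ p → ≤j (there p)))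

at : ∀ {n} → Vec Bool n → ℕ → Bool
at V.[] _ = false
at (x V.∷ v) zero = x
at (x V.∷ v) (suc b) = at v b

entry : ∀ {m n} → Vec (Vec Bool n) m → ℕ → ℕ → Bool
entry V.[] a b = false
entry (row V.∷ T) zero b = at row b
entry (row V.∷ T) (suc a) b = entry T a b

lookup≡at : ∀ {n} (v : Vec Bool n) l → V.lookup v l ≡ at v (toℕ l)
lookup≡at (x V.∷ v) Fin.zero = refl
lookup≡at (x V.∷ v) (Fin.suc l) = lookup≡at v l

lookup≡entry : ∀ {m n} (T : Vec (Vec Bool n) m) i l → V.lookup (V.lookup T i) l ≡ entry T (toℕ i) (toℕ l)
lookup≡entry (row V.∷ T) Fin.zero l = lookup≡at row l
lookup≡entry (row V.∷ T) (Fin.suc i) l = lookup≡entry T i l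

at-true⇒< : ∀ {n} (v : Vec Bool n) b → at v b ≡ true → b < n
at-true⇒< (x V.∷ v) zero _ = s≤s z≤n
at-true⇒< (x V.∷ v) (suc b) e = s≤s (at-true⇒< v b e)

entry-true⇒< : ∀ {m n} (T : Vec (Vec Bool n) m) a b → entry T a b ≡ true → a < m × b < n
entry-true⇒< (row V.∷ T) zero b e = s≤s z≤n , at-true⇒< row b e
entry-true⇒< (row V.∷ T) (suc a) b e with entry-true⇒< T a b e
... | a< , b< = s≤s a< , b<

at-ext : ∀ {n} (v w : Vec Bool n) → (∀ b → b < n → at v b ≡ at w b) → v ≡ w
at-ext V.[] V.[] _ = refl
at-ext (x V.∷ v) (y V.∷ w) eq = cong₂ V._∷_ (eq 0 (s≤s z≤n)) (at-ext v w λ b b< → eq (suc b) (s≤s b<))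

entry-ext : ∀ {m n} (T T′ : Vec (Vec Bool n) m) → (∀ a b → a < m → b < n → entry T a b ≡ entry T′ a b) → T ≡ T′
entry-ext V.[] V.[] _ = refl
entry-ext (x V.∷ T) (y V.∷ T′) eq = cong₂ V._∷_ (at-ext x y λ b b< → eq 0 b (s≤s z≤n) b<)
  (entry-ext T T′ λ a b a< b< → eq (suc a) b (s≤s a<) b<)

matrix : ∀ m n → (ℕ → ℕ → Bool) → Vec (Vec Bool n) m
matrix m n f = V.tabulate λ i → V.tabulate λ l → f (toℕ i) (toℕ l)

entry-matrix : ∀ {m n} f {a b} → a < m → b < n → entry (matrix m n f) a b ≡ f a b
entry-matrix {m} {n} f {a} {b} a< b< = begin
  entry (matrix m n f) a b                   ≡⟨ cong₂ (entry (matrix m n f)) (sym (toℕ-fromℕ< a<)) (sym (toℕ-fromℕ< b<)) ⟩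
  entry (matrix m n f) (toℕ i) (toℕ l)        ≡⟨ sym (lookup≡entry (matrix m n f) i l) ⟩
  V.lookup (V.lookup (matrix m n f) i) l     ≡⟨ cong (λ row → V.lookup row l) (lookup∘tabulate _ i) ⟩
  V.lookup (V.tabulate λ l → f (toℕ i) (toℕ l)) l ≡⟨ lookup∘tabulate _ l ⟩
  f (toℕ i) (toℕ l)                         ≡⟨ cong₂ f (toℕ-fromℕ< a<) (toℕ-fromℕ< b<) ⟩
  f a b ∎
  where
  open ≡-Reasoning
  i = fromℕ< a<
  l = fromℕ< b<

entry-matrix-true : ∀ m n f {a b} → entry (matrix m n f) a b ≡ true → f a b ≡ true
entry-matrix-true m n f {a} {b} e with entry-true⇒< (matrix m n f) a b e
... | a< , b< = trans (sym (entry-matrix f a< b<)) e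

toList-tabulate : ∀ {n} {A : Set} (h : Fin n → A) (g : ℕ → A) → (∀ i → h i ≡ g (toℕ i)) →
  V.toList (V.tabulate h) ≡ applyUpTo g n
toList-tabulate {zero} h g h≗g = refl
toList-tabulate {suc n} h g h≗g = cong₂ _∷_ (h≗g Fin.zero)
  (toList-tabulate (λ i → h (Fin.suc i)) (λ b → g (suc b)) (λ i → h≗g (Fin.suc i)))

degJ≡countBelow : ∀ I J (T : Graph I J) l → degJ I J T l ≡ countBelow (length I) (λ a → entry T a (toℕ l))
degJ≡countBelow I J T l = go T
  where
  go : ∀ {m} (T : Vec (Vec Bool (length J)) m) →
    V.foldr _ (λ row acc → (if V.lookup row l then 1 else 0) + acc) 0 T ≡ countBelow m (λ a → entry T a (toℕ l))
  go V.[] = refl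
  go {suc m} (row V.∷ T) = trans (cong₂ (λ x y → (if x then 1 else 0) + y) (lookup≡at row l) (go T))
                         (sym (countBelow-suc m (λ a → entry (row V.∷ T) a (toℕ l))))

rho≡rhoWord-degrees : ∀ I J (T : Graph I J) →
  rho I J T ≡ rhoWord (applyUpTo (λ b → countBelow (length I) (λ a → entry T a b)) (length J))
rho≡rhoWord-degrees I J T = cong rhoWord (trans (cong V.toList (sym (tabulate-∘ (degJ I J T) (λ i → i))))
  (toList-tabulate _ _ (degJ≡countBelow I J T)))

-- ν(I, J̄) in blocks

mergeTags-[] : ∀ I → mergeTags I [] ≡ map (λ _ → true) I
mergeTags-[] [] = refl
mergeTags-[] (i ∷ is) = cong (true ∷_) (mergeTags-[] is)

mergeTags-∷ : ∀ I j J → mergeTags I (j ∷ J) ≡ replicate (rank j I) true ++ false ∷ mergeTags (drop (rank j I) I) J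
mergeTags-∷ [] j J = refl
mergeTags-∷ (i ∷ is) j J with i ≤ᵇ j
... | true = cong (true ∷_) (mergeTags-∷ is j J)
... | false = refl

-- gaps I J lists, for each element of J̄, how many elements of I precede it and follow the previous one
gaps : List ℕ → List ℕ → List ℕ
gaps I [] = []
gaps I (j ∷ J) = rank j I ∷ gaps (drop (rank j I) I) J

tags : List ℕ → List Bool
tags [] = []
tags (g ∷ gs) = replicate g true ++ false ∷ tags gs

mergeTags≡tags : ∀ I J → mergeTags I J ≡ tags (gaps I J) ++ map (λ _ → true) (drop (sum (gaps I J)) I)
mergeTags≡tags I [] = mergeTags-[] I
mergeTags≡tags I (j ∷ J) = begin
  mergeTags I (j ∷ J)
    ≡⟨ mergeTags-∷ I j J ⟩
  replicate g true ++ false ∷ mergeTags (drop g I) J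
    ≡⟨ cong (λ z → replicate g true ++ false ∷ z) (mergeTags≡tags (drop g I) J) ⟩
  replicate g true ++ false ∷ (tags gs ++ rest)
    ≡⟨ sym (++-assoc (replicate g true) (false ∷ tags gs) rest) ⟩
  tags (g ∷ gs) ++ rest
    ≡⟨ cong (λ z → tags (g ∷ gs) ++ map (λ _ → true) z) (drop-drop g (sum gs) I) ⟩
  tags (g ∷ gs) ++ map (λ _ → true) (drop (g + sum gs) I) ∎
  where
  open ≡-Reasoning
  g = rank j I
  gs = gaps (drop g I) J
  rest = map (λ _ → true) (drop (sum gs) (drop g I))

length-gaps : ∀ I J → length (gaps I J) ≡ length J
length-gaps I [] = refl
length-gaps I (j ∷ J) = cong suc (length-gaps _ J)

rank-drop : ∀ {j j′} I → j′ ≤ j → rank j (drop (rank j′ I) I) + rank j′ I ≡ rank j I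
rank-drop [] _ = refl
rank-drop {j} {j′} (i ∷ is) j′≤j with i ≤ᵇ j′ in eq
... | false = +-identityʳ _
... | true rewrite ≤⇒≤ᵇ≡true (≤-trans (≤ᵇ≡true⇒≤ i j′ eq) j′≤j) =
  trans (+-suc _ _) (cong suc (rank-drop is j′≤j))

sum-take-gaps : ∀ I J → Linked _<_ J → ∀ {b} → b < length J → sum (take (suc b) (gaps I J)) ≡ rank (nth J b) I
sum-take-gaps I (j ∷ J) _ {zero} _ = +-identityʳ _
sum-take-gaps I (j ∷ J) l {suc b} (s≤s b<) =
  trans (cong (rank j I +_) (sum-take-gaps (drop (rank j I) I) J (linked-tail l) b<))
        (trans (+-comm (rank j I) _) (rank-drop I (<⇒≤ (head<nth J l b<))))

take-tags : ∀ g gs → map tagStep (take (g + sum gs + length gs) (tags (g ∷ gs))) ≡ blocks (g ∷ gs)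
take-tags (suc g) [] = cong (E ∷_) (take-tags g [])
take-tags (suc g) (g′ ∷ gs) = cong (E ∷_) (take-tags g (g′ ∷ gs))
take-tags zero [] = refl
take-tags zero (g′ ∷ gs) rewrite +-suc (g′ + sum gs) (length gs) = cong (N ∷_) (take-tags g′ gs)

-- The first element of I ⊔ J̄ lies in I, so the first gap is positive and the first tag is dropped
-- by ν; the last lies in J̄, so no element of I is left over.
nuPath-blocks : ∀ I j J → Linked _<_ (j ∷ J) → 0 < rank j I → rank (nth (j ∷ J) (length J)) I ≡ length I →
  ∃[ as ] (nuPath I (j ∷ J) ≡ blocks as × length as ≡ suc (length J)
           × (∀ b → b < suc (length J) → suc (sum (take (suc b) as)) ≡ rank (nth (j ∷ J) b) I))
nuPath-blocks I j J J-sorted r0>0 r-last with rank j I in r0≡ | r0>0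
... | suc g | _ = g ∷ gs , ν≡ , cong suc (length-gaps (drop (suc g) I) J) , sums
  where
  open ≡-Reasoning
  gs = gaps (drop (suc g) I) J

  gaps≡ : gaps I (j ∷ J) ≡ suc g ∷ gs
  gaps≡ = cong (λ z → z ∷ gaps (drop z I) J) r0≡

  sums : ∀ b → b < suc (length J) → suc (sum (take (suc b) (g ∷ gs))) ≡ rank (nth (j ∷ J) b) I
  sums b b< = trans (cong (λ z → sum (take (suc b) z)) (sym gaps≡)) (sum-take-gaps I (j ∷ J) J-sorted b<)

  length-I : suc (sum (g ∷ gs)) ≡ length I
  length-I = trans (cong (λ z → suc (sum z)) (sym (take-all (suc (length J)) (g ∷ gs)
                      (≤-reflexive (cong suc (length-gaps (drop (suc g) I) J))))))
               (trans (sums (length J) ≤-refl) r-last)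

  merge≡ : mergeTags I (j ∷ J) ≡ tags (suc g ∷ gs)
  merge≡ = begin
    mergeTags I (j ∷ J)
      ≡⟨ mergeTags≡tags I (j ∷ J) ⟩
    tags (gaps I (j ∷ J)) ++ map (λ _ → true) (drop (sum (gaps I (j ∷ J))) I)
      ≡⟨ cong (λ z → tags z ++ map (λ _ → true) (drop (sum z) I)) gaps≡ ⟩
    tags (suc g ∷ gs) ++ map (λ _ → true) (drop (suc (sum (g ∷ gs))) I)
      ≡⟨ cong (λ z → tags (suc g ∷ gs) ++ map (λ _ → true) z) (drop-all _ I (≤-reflexive (sym length-I))) ⟩
    tags (suc g ∷ gs) ++ []
      ≡⟨ ++-identityʳ _ ⟩
    tags (suc g ∷ gs) ∎

  steps≡ : length I + suc (length J) ∸ 2 ≡ g + sum gs + length gs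
  steps≡ = begin
    length I + suc (length J) ∸ 2
      ≡⟨ cong₂ (λ x y → x + suc y ∸ 2) (sym length-I) (sym (length-gaps (drop (suc g) I) J)) ⟩
    suc (g + sum gs) + suc (length gs) ∸ 2
      ≡⟨ cong (_∸ 1) (+-suc (g + sum gs) (length gs)) ⟩
    g + sum gs + length gs ∎

  ν≡ : nuPath I (j ∷ J) ≡ blocks (g ∷ gs)
  ν≡ = trans (cong₂ (λ n t → map tagStep (take n (drop 1 t))) steps≡ merge≡) (take-tags g gs)

-- Trees and ν-Dyck paths

applyUpTo-cong : ∀ {A : Set} n {f g : ℕ → A} → (∀ b → b < n → f b ≡ g b) → applyUpTo f n ≡ applyUpTo g n
applyUpTo-cong zero _ = refl
applyUpTo-cong (suc n) f≗g = cong₂ _∷_ (f≗g 0 (s≤s z≤n)) (applyUpTo-cong n λ b b< → f≗g (suc b) (s≤s b<))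

applyUpTo-nth : ∀ (f : ℕ → ℕ) xs → applyUpTo (λ b → f (nth xs b)) (length xs) ≡ map f xs
applyUpTo-nth f [] = refl
applyUpTo-nth f (x ∷ xs) = cong (f x ∷_) (applyUpTo-nth f xs)

nth-applyUpTo : ∀ (f : ℕ → ℕ) n {b} → b < n → nth (applyUpTo f n) b ≡ f b
nth-applyUpTo f (suc n) {zero} _ = refl
nth-applyUpTo f (suc n) {suc b} (s≤s b<) = nth-applyUpTo (λ b → f (suc b)) n b<

nth-map : ∀ (f : ℕ → ℕ) xs {b} → b < length xs → nth (map f xs) b ≡ f (nth xs b)
nth-map f (x ∷ xs) {zero} _ = refl
nth-map f (x ∷ xs) {suc b} (s≤s b<) = nth-map f xs b<

excesses : ℕ → (ℕ → ℕ) → List ℕ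
excesses n d = map (_∸ 1) (applyUpTo d n)

sum-take-excesses : ∀ d n {t} → t ≤ n → sum (take t (excesses n d)) ≡ excess d t
sum-take-excesses d n {zero} _ = refl
sum-take-excesses d (suc n) {suc t} (s≤s t≤) =
  trans (cong ((d 0 ∸ 1) +_) (sum-take-excesses (λ b → d (suc b)) n t≤)) (sym (excess-suc d t))

length-excesses : ∀ n d → length (excesses n d) ≡ n
length-excesses n d = trans (length-map (_∸ 1) (applyUpTo d n)) (length-applyUpTo d n)

sum-excesses : ∀ n d → sum (excesses n d) ≡ excess d n
sum-excesses n d = trans (cong sum (sym (take-all n (excesses n d) (≤-reflexive (length-excesses n d)))))
  (sum-take-excesses d n ≤-refl)

nth-excesses : ∀ n d {b} → b < n → nth (excesses n d) b ≡ d b ∸ 1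
nth-excesses n d b< = trans (nth-map (_∸ 1) (applyUpTo d n) (subst (_ <_) (sym (length-applyUpTo d n)) b<))
  (cong (_∸ 1) (nth-applyUpTo d n b<))

∸1-cancel : ∀ {x y} → 1 ≤ x → 1 ≤ y → x ∸ 1 ≡ y ∸ 1 → x ≡ y
∸1-cancel {suc x} {suc y} _ _ = cong suc

map-∸1-suc : ∀ xs → map (_∸ 1) (map suc xs) ≡ xs
map-∸1-suc xs = trans (sym (map-∘ xs)) (map-id xs)

withArc : (ℕ → ℕ → Bool) → ℕ → ℕ → ℕ → ℕ → Bool
withArc G c b a y with a ≟ c | y ≟ b
... | yes _ | yes _ = true
... | _ | _ = G a y

withArc-true⁻ : ∀ G c b a y → withArc G c b a y ≡ true → G a y ≡ true ⊎ (a ≡ c × y ≡ b)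
withArc-true⁻ G c b a y e with a ≟ c | y ≟ b
... | yes a≡c | yes y≡b = inj₂ (a≡c , y≡b)
... | yes _ | no _ = inj₁ e
... | no _ | _ = inj₁ e

withArc-old : ∀ G c b a y → G a y ≡ true → withArc G c b a y ≡ true
withArc-old G c b a y e with a ≟ c | y ≟ b
... | yes _ | yes _ = refl
... | yes _ | no _ = e
... | no _ | _ = e

withArc-new : ∀ G c b → withArc G c b c b ≡ true
withArc-new G c b with c ≟ c | b ≟ b
... | yes _ | yes _ = refl
... | no c≢c | _ = ⊥-elim (c≢c refl)
... | yes _ | no b≢b = ⊥-elim (b≢b refl)

module Trees (I : List ℕ) (j : ℕ) (J : List ℕ) (I-sorted : Linked _<_ I) (J-sorted : Linked _<_ (j ∷ J))
  (I≢[] : I ≢ [])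
  (min∈I : ∃[ i ] (i ∈ I × (∀ j′ → j′ ∈ j ∷ J → i ≤ j′)))
  (max∈J : ∃[ j′ ] (j′ ∈ j ∷ J × (∀ i → i ∈ I → i ≤ j′))) where

  m k′ : ℕ
  m = length I
  k′ = length J

  r : ℕ → ℕ
  r b = rank (nth (j ∷ J) b) I

  r-mono : ∀ {b b′} → b ≤ b′ → b′ < suc k′ → r b ≤ r b′
  r-mono b≤b′ b′< = rank-mono I (nth-mono-≤ (j ∷ J) J-sorted b≤b′ b′<)

  r0>0 : 0 < r 0
  r0>0 = from-min min∈I
    where
    from-min : ∃[ i ] (i ∈ I × (∀ j′ → j′ ∈ j ∷ J → i ≤ j′)) → 0 < r 0
    from-min (i , i∈ , i≤) with ∈⇒nth I i∈
    ... | a , a< , refl = nth≤⇒<rank j I I-sorted (≤-<-trans z≤n a<)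
            (≤-trans (nth-mono-≤ I I-sorted z≤n a<) (i≤ j (here refl)))

  r-last : r k′ ≡ m
  r-last = from-max max∈J
    where
    from-max : ∃[ j′ ] (j′ ∈ j ∷ J × (∀ i → i ∈ I → i ≤ j′)) → r k′ ≡ m
    from-max (j′ , j′∈ , ≤j′) with ∈⇒nth (j ∷ J) j′∈
    ... | c , c< , refl = rank-all _ I λ i∈ → ≤-trans (≤j′ _ i∈) (nth-mono-≤ (j ∷ J) J-sorted (s≤s⁻¹ c<) ≤-refl)

  open Staircase m k′ r r-mono r0>0 r-last

  allowed⇒ : ∀ (i : Fin m) (l : Fin k) → lookup I i ≤ lookup (j ∷ J) l → toℕ i < r (toℕ l)
  allowed⇒ i l i≤l = nth≤⇒<rank _ I I-sorted (toℕ<n i) (subst₂ _≤_ (lookup≡nth I i) (lookup≡nth (j ∷ J) l) i≤l)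

  allowed⇐ : ∀ (i : Fin m) (l : Fin k) → toℕ i < r (toℕ l) → lookup I i ≤ lookup (j ∷ J) l
  allowed⇐ i l i<r = subst₂ _≤_ (sym (lookup≡nth I i)) (sym (lookup≡nth (j ∷ J) l)) (<rank⇒nth≤ _ I i<r)

  lookup-<⇒ : ∀ xs → Linked _<_ xs → (i i′ : Fin (length xs)) → lookup xs i < lookup xs i′ → toℕ i < toℕ i′
  lookup-<⇒ xs sorted i i′ i<i′ =
    nth-cancel-< xs sorted (toℕ<n i) (subst₂ _<_ (lookup≡nth xs i) (lookup≡nth xs i′) i<i′)

  lookup-<⇐ : ∀ xs → Linked _<_ xs → (i i′ : Fin (length xs)) → toℕ i < toℕ i′ → lookup xs i < lookup xs i′
  lookup-<⇐ xs sorted i i′ i<i′ = subst₂ _<_ (sym (lookup≡nth xs i)) (sym (lookup≡nth xs i′))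
    (nth-mono-< xs sorted i<i′ (toℕ<n i′))

  arc-index : ∀ (T : Graph I (j ∷ J)) {a b} → entry T a b ≡ true →
    Σ (Fin m) λ i → Σ (Fin k) λ l → toℕ i ≡ a × toℕ l ≡ b × arc {I} {j ∷ J} T i l ≡ true
  arc-index T {a} {b} e with entry-true⇒< T a b e
  ... | a< , b< = fromℕ< a< , fromℕ< b< , toℕ-fromℕ< a< , toℕ-fromℕ< b<
      , trans (lookup≡entry T _ _)
              (subst₂ (λ x y → entry T x y ≡ true) (sym (toℕ-fromℕ< a<)) (sym (toℕ-fromℕ< b<)) e)

  arc⇒entry : ∀ (T : Graph I (j ∷ J)) i l → arc {I} {j ∷ J} T i l ≡ true → entry T (toℕ i) (toℕ l) ≡ true
  arc⇒entry T i l e = trans (sym (lookup≡entry T i l)) e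

  forest⇒ : ∀ T → IsForest I (j ∷ J) T → Allowed (entry T) × NonCrossing (entry T)
  forest⇒ T (below , noncross) = allowed , noncrossing
    where
    allowed : Allowed (entry T)
    allowed a b e with arc-index T e
    ... | i , l , refl , refl , il = allowed⇒ i l (below i l il)
    noncrossing : NonCrossing (entry T)
    noncrossing a b c d e e′ a<c c<rb b<d with arc-index T e | arc-index T e′
    ... | i , l , refl , refl , il | i′ , l′ , refl , refl , il′ =
      noncross i l i′ l′ il il′
        (lookup-<⇐ I I-sorted i i′ a<c , allowed⇐ i′ l c<rb , lookup-<⇐ (j ∷ J) J-sorted l l′ b<d)

  forest⇐ : ∀ T → Allowed (entry T) → NonCrossing (entry T) → IsForest I (j ∷ J) T
  forest⇐ T allowed noncrossing =
    (λ i l il → allowed⇐ i l (allowed _ _ (arc⇒entry T i l il))) ,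
    (λ i l i′ l′ il il′ (i< , ≤j , l<) → noncrossing _ _ _ _ (arc⇒entry T i l il) (arc⇒entry T i′ l′ il′)
       (lookup-<⇒ I I-sorted i i′ i<) (allowed⇒ i′ l ≤j) (lookup-<⇒ (j ∷ J) J-sorted l l′ l<))

  subgraph⇒ : ∀ T T′ → SubGraph I (j ∷ J) T T′ → ∀ {a b} → entry T a b ≡ true → entry T′ a b ≡ true
  subgraph⇒ T T′ sub e with arc-index T e
  ... | i , l , refl , refl , il = arc⇒entry T′ i l (sub i l il)

  -- adding a non-crossing arc (c , b) would contradict maximality
  tree⇒saturated : ∀ T → IsTree I (j ∷ J) T → Saturated (entry T)
  tree⇒saturated T (forest , maximal) c b c<r b<k cb ¬above ¬below =
    contradiction (trans (sym cb) (subst (λ Z → entry Z c b ≡ true) T′≡T new)) λ ()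
    where
    allowed : Allowed (entry T)
    allowed = proj₁ (forest⇒ T forest)
    noncrossing : NonCrossing (entry T)
    noncrossing = proj₂ (forest⇒ T forest)
    G′ : Arcs
    G′ = withArc (entry T) c b
    T′ : Graph I (j ∷ J)
    T′ = matrix m k G′
    new : entry T′ c b ≡ true
    new = trans (entry-matrix G′ (<-≤-trans c<r (r≤m b<k)) b<k) (withArc-new (entry T) c b)
    allowed′ : Allowed (entry T′)
    allowed′ a y e with withArc-true⁻ (entry T) c b a y (entry-matrix-true m k G′ e)
    ... | inj₁ ay = allowed a y ay
    ... | inj₂ (refl , refl) = c<r
    noncrossing′ : NonCrossing (entry T′)
    noncrossing′ a y a′ y′ e e′ a<a′ a′<r y<y′
      with withArc-true⁻ (entry T) c b a y (entry-matrix-true m k G′ e)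
         | withArc-true⁻ (entry T) c b a′ y′ (entry-matrix-true m k G′ e′)
    ... | inj₁ ay | inj₁ a′y′ = noncrossing a y a′ y′ ay a′y′ a<a′ a′<r y<y′
    ... | inj₂ (refl , refl) | inj₁ a′y′ = ¬above (a′ , y′ , a′y′ , a<a′ , a′<r , y<y′)
    ... | inj₁ ay | inj₂ (refl , refl) = ¬below (a , y , ay , a<a′ , a′<r , y<y′)
    ... | inj₂ (refl , refl) | inj₂ (refl , refl) = <-irrefl refl a<a′
    sub : SubGraph I (j ∷ J) T T′
    sub i l il = trans (lookup≡entry T′ i l) (trans (entry-matrix G′ (toℕ<n i) (toℕ<n l))
      (withArc-old (entry T) c b _ _ (arc⇒entry T i l il)))
    T′≡T : T′ ≡ T
    T′≡T = maximal T′ (forest⇐ T′ allowed′ noncrossing′) sub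

  νs : List ℕ
  νs = proj₁ (nuPath-blocks I j J J-sorted r0>0 r-last)

  ν≡ : nuPath I (j ∷ J) ≡ blocks νs
  ν≡ = proj₁ (proj₂ (nuPath-blocks I j J J-sorted r0>0 r-last))

  length-νs : length νs ≡ k
  length-νs = proj₁ (proj₂ (proj₂ (nuPath-blocks I j J J-sorted r0>0 r-last)))

  sum-take-νs : ∀ b → b < k → suc (sum (take (suc b) νs)) ≡ r b
  sum-take-νs = proj₂ (proj₂ (proj₂ (nuPath-blocks I j J J-sorted r0>0 r-last)))

  sum-νs : suc (sum νs) ≡ m
  sum-νs = trans (cong (λ z → suc (sum z)) (sym (take-all k νs (≤-reflexive length-νs))))
    (trans (sum-take-νs k′ ≤-refl) r-last)

  admissible⇒dyck : ∀ d → Admissible d → IsDyck (nuPath I (j ∷ J)) (rhoWord (applyUpTo d k))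
  admissible⇒dyck d (_ , bound , total) = subst₂ IsDyck (sym ν≡) (sym (rhoWord≡blocks (applyUpTo d k)))
    (blocks-dyck⇐ νs (excesses k d) (trans length-νs (sym (length-excesses k d))) prefix sums)
    where
    prefix : PrefixSums≤ (excesses k d) νs
    prefix zero _ = z≤n
    prefix (suc b) sb< = s≤s⁻¹ (subst₂ _<_ (sym (sum-take-excesses d k (<⇒≤ sb<k))) (sym (sum-take-νs b (<⇒≤ sb<k)))
                                 (bound b (<⇒≤ sb<k)))
      where sb<k = subst (suc b <_) length-νs sb<
    sums : sum (excesses k d) ≡ sum νs
    sums = suc-injective (trans (cong suc (sum-excesses k d)) (trans total (sym sum-νs)))

  dyck⇒admissible : ∀ d → (∀ b → b < k → 1 ≤ d b) → IsDyck (nuPath I (j ∷ J)) (rhoWord (applyUpTo d k)) → Admissible d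
  dyck⇒admissible d d≥1 dyck = d≥1 , bound , total
    where
    criterion : PrefixSums≤ (excesses k d) νs × sum (excesses k d) ≡ sum νs
    criterion = blocks-dyck⇒ νs (excesses k d) (trans length-νs (sym (length-excesses k d)))
      (subst₂ IsDyck ν≡ (rhoWord≡blocks (applyUpTo d k)) dyck)
    sums : sum (excesses k d) ≡ sum νs
    sums = proj₂ criterion
    total : suc (excess d k) ≡ m
    total = trans (cong suc (trans (sym (sum-excesses k d)) sums)) sum-νs
    excess≤ : ∀ b → b < k → excess d (suc b) ≤ sum (take (suc b) νs)
    excess≤ b b<k with m<1+n⇒m<n∨m≡n b<k
    ... | inj₁ b<k′ = subst (_≤ sum (take (suc b) νs)) (sum-take-excesses d k (m≤n⇒m≤1+n b<k′))
                        (proj₁ criterion (suc b) (subst (suc b <_) (sym length-νs) (s≤s b<k′)))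
    ... | inj₂ refl = ≤-reflexive (trans (sym (sum-excesses k d))
                        (trans sums (cong sum (sym (take-all k νs (≤-reflexive length-νs))))))
    bound : ∀ b → b < k → excess d (suc b) < r b
    bound b b<k = subst (excess d (suc b) <_) (sum-take-νs b b<k) (s≤s (excess≤ b b<k))

  module OfTree (T : Graph I (j ∷ J)) (tree : IsTree I (j ∷ J) T) =
    TreeColumns (entry T) (proj₁ (forest⇒ T (proj₁ tree))) (λ a b e → proj₂ (entry-true⇒< T a b e))
      (proj₂ (forest⇒ T (proj₁ tree))) (tree⇒saturated T tree)

  tree⇒dyck : ∀ T → IsTree I (j ∷ J) T → IsDyck (nuPath I (j ∷ J)) (rho I (j ∷ J) T)
  tree⇒dyck T tree = subst (IsDyck _) (sym (rho≡rhoWord-degrees I (j ∷ J) T))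
    (admissible⇒dyck _ (OfTree.degree-admissible T tree))

  -- a tree is determined by its degrees, since each column is the top of the stack they determine
  rho-injective : ∀ T T′ → IsTree I (j ∷ J) T → IsTree I (j ∷ J) T′ → rho I (j ∷ J) T ≡ rho I (j ∷ J) T′ → T ≡ T′
  rho-injective T T′ tree tree′ eq = entry-ext T T′ λ a b _ b<k → begin
    entry T a b                         ≡⟨ OfTree.G≡top T tree b<k a ⟩
    mem a (take (d b) (stack d b))     ≡⟨ cong₂ (λ n s → mem a (take n s)) (d≡d′ b<k)
                                            (stack-cong b λ b′ b′<b → d≡d′ (<-trans b′<b b<k)) ⟩
    mem a (take (d′ b) (stack d′ b))   ≡⟨ sym (OfTree.G≡top T′ tree′ b<k a) ⟩
    entry T′ a b ∎
    where
    open ≡-Reasoning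
    d = OfTree.degree T tree
    d′ = OfTree.degree T′ tree′
    excesses≡ : excesses k d ≡ excesses k d′
    excesses≡ = blocks-injective _ _ _ _ (begin
      blocks (excesses k d) ≡⟨ sym (rhoWord≡blocks (applyUpTo d k)) ⟩
      rhoWord (applyUpTo d k) ≡⟨ sym (rho≡rhoWord-degrees I (j ∷ J) T) ⟩
      rho I (j ∷ J) T ≡⟨ eq ⟩
      rho I (j ∷ J) T′ ≡⟨ rho≡rhoWord-degrees I (j ∷ J) T′ ⟩
      rhoWord (applyUpTo d′ k) ≡⟨ rhoWord≡blocks (applyUpTo d′ k) ⟩
      blocks (excesses k d′) ∎)
    d≡d′ : ∀ {b} → b < k → d b ≡ d′ b
    d≡d′ {b} b<k = ∸1-cancel
      (proj₁ (OfTree.degree-admissible T tree) b b<k) (proj₁ (OfTree.degree-admissible T′ tree′) b b<k)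
      (trans (sym (nth-excesses k d b<k)) (trans (cong (λ xs → nth xs b) excesses≡) (nth-excesses k d′ b<k)))

  module OfAdmissible (d : ℕ → ℕ) (admissible : Admissible d) where
    open FromAdmissible d admissible

    tree-of : Graph I (j ∷ J)
    tree-of = matrix m k G

    entry-tree : ∀ {a b} → a < m → b < k → entry tree-of a b ≡ G a b
    entry-tree = entry-matrix G

    G⇒entry : ∀ {a b} → G a b ≡ true → entry tree-of a b ≡ true
    G⇒entry {a} {b} e = trans (entry-tree (<-≤-trans (allowed a b e) (r≤m b<k)) b<k) e
      where b<k = column<k a b e

    maximal : ∀ T′ → IsForest I (j ∷ J) T′ → SubGraph I (j ∷ J) tree-of T′ → T′ ≡ tree-of
    maximal T′ forest′ sub = entry-ext T′ tree-of λ a b a< b< →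
      trans (⇔→≡ (mk⇔ T′⇒G G⇒T′)) (sym (entry-tree a< b<))
      where
      allowed′ : Allowed (entry T′)
      allowed′ = proj₁ (forest⇒ T′ forest′)
      noncrossing′ : NonCrossing (entry T′)
      noncrossing′ = proj₂ (forest⇒ T′ forest′)
      G⇒T′ : ∀ {x y} → G x y ≡ true → entry T′ x y ≡ true
      G⇒T′ e = subgraph⇒ tree-of T′ sub (G⇒entry e)
      T′⇒G : ∀ {a b} → entry T′ a b ≡ true → G a b ≡ true
      T′⇒G {a} {b} e with G a b in ab
      ... | true = refl
      ... | false with blocked a b (allowed′ a b e) (proj₂ (entry-true⇒< T′ a b e)) ab
      ... | inj₁ (x , y , xy , a<x , x<r , b<y) = ⊥-elim (noncrossing′ a b x y e (G⇒T′ xy) a<x x<r b<y)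
      ... | inj₂ (x , y , xy , x<a , a<r , y<b) = ⊥-elim (noncrossing′ x y a b (G⇒T′ xy) e x<a a<r y<b)

    isTree : IsTree I (j ∷ J) tree-of
    isTree = forest⇐ tree-of (λ a b e → allowed a b (entry-matrix-true m k G e))
                             (λ a b c y e e′ → noncrossing a b c y (entry-matrix-true m k G e)
                                                                     (entry-matrix-true m k G e′)) ,
             maximal

    rho-tree : rho I (j ∷ J) tree-of ≡ rhoWord (applyUpTo d k)
    rho-tree = trans (rho≡rhoWord-degrees I (j ∷ J) tree-of) (cong rhoWord (applyUpTo-cong k λ b b<k →
      trans (countBelow-cong m λ a a< → entry-tree a< b<k) (degree-G b<k)))

  rho-surjective : ∀ π → IsDyck (nuPath I (j ∷ J)) π → ∃[ T ] (IsTree I (j ∷ J) T × rho I (j ∷ J) T ≡ π)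
  rho-surjective π dyck = OfAdmissible.tree-of d admissible , OfAdmissible.isTree d admissible ,
    trans (OfAdmissible.rho-tree d admissible) (sym π≡)
    where
    open ≡-Reasoning
    as = uncurry _∷_ (unblocks π)
    d : ℕ → ℕ
    d b = suc (nth as b)
    countN-ν : countN (nuPath I (j ∷ J)) ≡ k′
    countN-ν = trans (cong countN ν≡) (trans (countN-blocks νs) (cong pred length-νs))
    length-as : length as ≡ k
    length-as = cong suc (trans (length-unblocks π) (trans (proj₁ (proj₂ dyck)) countN-ν))
    π≡ : π ≡ rhoWord (applyUpTo d k)
    π≡ = begin
      π                                    ≡⟨ sym (blocks-unblocks π) ⟩
      blocks as                            ≡⟨ cong blocks (sym (map-∸1-suc as)) ⟩
      blocks (map (_∸ 1) (map suc as))     ≡⟨ sym (rhoWord≡blocks (map suc as)) ⟩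
      rhoWord (map suc as)                 ≡⟨ cong rhoWord (sym (applyUpTo-nth suc as)) ⟩
      rhoWord (applyUpTo d (length as))    ≡⟨ cong (λ n → rhoWord (applyUpTo d n)) length-as ⟩
      rhoWord (applyUpTo d k) ∎
    admissible = dyck⇒admissible d (λ _ _ → s≤s z≤n) (subst (IsDyck _) π≡ dyck)

-- Every lattice path is some ν(I, J̄)

positionsI : ℕ → LatticePath → List ℕ
positionsI o [] = []
positionsI o (E ∷ w) = o ∷ positionsI (suc o) w
positionsI o (N ∷ w) = positionsI (suc o) w

positionsJ : ℕ → LatticePath → List ℕ
positionsJ o [] = o ∷ []
positionsJ o (E ∷ w) = positionsJ (suc o) w
positionsJ o (N ∷ w) = o ∷ positionsJ (suc o) w

private
  widen : ∀ {o x} n → suc o ≤ x × x ≤ suc o + n → o ≤ x × x ≤ o + suc n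
  widen {o} {x} n (o<x , x≤) = <⇒≤ o<x , subst (x ≤_) (sym (+-suc o n)) x≤

positions-bounded : ∀ o w {x} → x ∈ positionsI o w ⊎ x ∈ positionsJ o w → o ≤ x × x ≤ o + length w
positions-bounded o [] (inj₂ (here refl)) = ≤-refl , ≤-reflexive (sym (+-identityʳ o))
positions-bounded o (E ∷ w) (inj₁ (here refl)) = ≤-refl , m≤m+n o _
positions-bounded o (N ∷ w) (inj₂ (here refl)) = ≤-refl , m≤m+n o _
positions-bounded o (E ∷ w) (inj₁ (there p)) = widen (length w) (positions-bounded (suc o) w (inj₁ p))
positions-bounded o (E ∷ w) (inj₂ p) = widen (length w) (positions-bounded (suc o) w (inj₂ p))
positions-bounded o (N ∷ w) (inj₁ p) = widen (length w) (positions-bounded (suc o) w (inj₁ p))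
positions-bounded o (N ∷ w) (inj₂ (there p)) = widen (length w) (positions-bounded (suc o) w (inj₂ p))

positions-cover : ∀ o w {x} → o ≤ x → x ≤ o + length w → x ∈ positionsI o w ⊎ x ∈ positionsJ o w
positions-cover o [] o≤x x≤ = inj₂ (here (≤-antisym (subst (_ ≤_) (+-identityʳ o) x≤) o≤x))
positions-cover o (E ∷ w) {x} o≤x x≤ with x ≟ o
... | yes refl = inj₁ (here refl)
... | no x≢o with positions-cover (suc o) w (≤∧≢⇒< o≤x (x≢o ∘ sym)) (subst (x ≤_) (+-suc o (length w)) x≤)
...   | inj₁ p = inj₁ (there p)
...   | inj₂ q = inj₂ q
positions-cover o (N ∷ w) {x} o≤x x≤ with x ≟ o
... | yes refl = inj₂ (here refl)
... | no x≢o with positions-cover (suc o) w (≤∧≢⇒< o≤x (x≢o ∘ sym)) (subst (x ≤_) (+-suc o (length w)) x≤)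
...   | inj₁ p = inj₁ p
...   | inj₂ q = inj₂ (there q)

positions-disjoint : ∀ o w {x} → x ∈ positionsI o w → x ∈ positionsJ o w → ⊥
positions-disjoint o (E ∷ w) (here refl) q = <-irrefl refl (proj₁ (positions-bounded (suc o) w (inj₂ q)))
positions-disjoint o (E ∷ w) (there p) q = positions-disjoint (suc o) w p q
positions-disjoint o (N ∷ w) p (here refl) = <-irrefl refl (proj₁ (positions-bounded (suc o) w (inj₁ p)))
positions-disjoint o (N ∷ w) p (there q) = positions-disjoint (suc o) w p q

linked-∷ : ∀ {x} xs → (∀ {y} → y ∈ xs → x < y) → Linked _<_ xs → Linked _<_ (x ∷ xs)
linked-∷ [] _ _ = [-]
linked-∷ (y ∷ xs) x< l = x< (here refl) ∷ l

positionsI-sorted : ∀ o w → Linked _<_ (positionsI o w)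
positionsI-sorted o [] = []
positionsI-sorted o (E ∷ w) =
  linked-∷ _ (λ p → proj₁ (positions-bounded (suc o) w (inj₁ p))) (positionsI-sorted (suc o) w)
positionsI-sorted o (N ∷ w) = positionsI-sorted (suc o) w

positionsJ-sorted : ∀ o w → Linked _<_ (positionsJ o w)
positionsJ-sorted o [] = [-]
positionsJ-sorted o (E ∷ w) = positionsJ-sorted (suc o) w
positionsJ-sorted o (N ∷ w) =
  linked-∷ _ (λ p → proj₁ (positions-bounded (suc o) w (inj₂ p))) (positionsJ-sorted (suc o) w)

length-positions : ∀ o w → length (positionsI o w) + length (positionsJ o w) ≡ suc (length w)
length-positions o [] = refl
length-positions o (E ∷ w) = cong suc (length-positions (suc o) w)
length-positions o (N ∷ w) = trans (+-suc _ _) (cong suc (length-positions (suc o) w))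

positionsJ≢[] : ∀ o w → positionsJ o w ≢ []
positionsJ≢[] o (E ∷ w) = positionsJ≢[] (suc o) w

mergeTags-∷ˡ : ∀ x I J → (∀ {y} → y ∈ J → x ≤ y) → J ≢ [] → mergeTags (x ∷ I) J ≡ true ∷ mergeTags I J
mergeTags-∷ˡ x I [] _ J≢[] = ⊥-elim (J≢[] refl)
mergeTags-∷ˡ x I (j ∷ J) x≤ _ rewrite ≤⇒≤ᵇ≡true (x≤ (here refl)) = refl

mergeTags-∷ʳ : ∀ x I J → (∀ {y} → y ∈ I → x < y) → mergeTags I (x ∷ J) ≡ false ∷ mergeTags I J
mergeTags-∷ʳ x [] J _ = refl
mergeTags-∷ʳ x (i ∷ I) J x< with i ≤ᵇ x in eq
... | false = refl
... | true = ⊥-elim (<⇒≱ (x< (here refl)) (≤ᵇ≡true⇒≤ i x eq))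

tag : Step → Bool
tag E = true
tag N = false

mergeTags-positions : ∀ o w → mergeTags (positionsI o w) (positionsJ o w) ≡ map tag w ++ false ∷ []
mergeTags-positions o [] = refl
mergeTags-positions o (E ∷ w) = trans
  (mergeTags-∷ˡ o _ _ (λ p → <⇒≤ (proj₁ (positions-bounded (suc o) w (inj₂ p)))) (positionsJ≢[] (suc o) w))
  (cong (true ∷_) (mergeTags-positions (suc o) w))
mergeTags-positions o (N ∷ w) = trans
  (mergeTags-∷ʳ o _ _ (λ p → proj₁ (positions-bounded (suc o) w (inj₁ p))))
  (cong (false ∷_) (mergeTags-positions (suc o) w))

take-tags-of : ∀ (w : LatticePath) → map tagStep (take (length w) (map tag w ++ false ∷ [])) ≡ w
take-tags-of [] = refl
take-tags-of (E ∷ w) = cong (E ∷_) (take-tags-of w)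
take-tags-of (N ∷ w) = cong (N ∷_) (take-tags-of w)

nuPath-surjective : (ν : LatticePath) → ∃[ I ] ∃[ J ] (Linked _<_ I × Linked _<_ J
  × (∀ n → n ∈ I → n ∈ J → ⊥)
  × (∀ n → (n ∈ I ⊎ n ∈ J) → n ≤ suc (length ν))
  × (∀ n → n ≤ suc (length ν) → n ∈ I ⊎ n ∈ J)
  × nuPath I J ≡ ν)
nuPath-surjective ν = 0 ∷ positionsI 1 ν , positionsJ 1 ν ,
  linked-∷ _ (λ p → proj₁ (positions-bounded 1 ν (inj₁ p))) (positionsI-sorted 1 ν) ,
  positionsJ-sorted 1 ν , disjoint , bounded , cover , ν≡
  where
  disjoint : ∀ n → n ∈ 0 ∷ positionsI 1 ν → n ∈ positionsJ 1 ν → ⊥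
  disjoint n (here refl) q = <-irrefl refl (proj₁ (positions-bounded 1 ν (inj₂ q)))
  disjoint n (there p) q = positions-disjoint 1 ν p q
  bounded : ∀ n → n ∈ 0 ∷ positionsI 1 ν ⊎ n ∈ positionsJ 1 ν → n ≤ suc (length ν)
  bounded n (inj₁ (here refl)) = z≤n
  bounded n (inj₁ (there p)) = proj₂ (positions-bounded 1 ν (inj₁ p))
  bounded n (inj₂ q) = proj₂ (positions-bounded 1 ν (inj₂ q))
  cover : ∀ n → n ≤ suc (length ν) → n ∈ 0 ∷ positionsI 1 ν ⊎ n ∈ positionsJ 1 ν
  cover zero _ = inj₁ (here refl)
  cover (suc n) n≤ with positions-cover 1 ν (s≤s z≤n) n≤
  ... | inj₁ p = inj₁ (there p)
  ... | inj₂ q = inj₂ q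
  ν≡ : nuPath (0 ∷ positionsI 1 ν) (positionsJ 1 ν) ≡ ν
  ν≡ = trans (cong₂ (λ n t → map tagStep (take n (drop 1 t))) (cong pred (length-positions 1 ν))
               (mergeTags-∷ˡ 0 (positionsI 1 ν) _ (λ _ → z≤n) (positionsJ≢[] 1 ν)))
         (trans (cong (λ t → map tagStep (take (length ν) t)) (mergeTags-positions 1 ν)) (take-tags-of ν))

rho-bijection : (I J : List ℕ) → Linked _<_ I → Linked _<_ J → I ≢ [] → J ≢ [] →
  (∃[ i ] (i ∈ I × (∀ j → j ∈ J → i ≤ j))) →
  (∃[ j ] (j ∈ J × (∀ i → i ∈ I → i ≤ j))) →
  (∀ T → IsTree I J T → IsDyck (nuPath I J) (rho I J T))
  × (∀ T T′ → IsTree I J T → IsTree I J T′ → rho I J T ≡ rho I J T′ → T ≡ T′)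
  × (∀ π → IsDyck (nuPath I J) π → ∃[ T ] (IsTree I J T × rho I J T ≡ π))
rho-bijection I [] _ _ _ J≢[] _ _ = ⊥-elim (J≢[] refl)
rho-bijection I (j ∷ J) I-sorted J-sorted I≢[] _ min∈I max∈J = tree⇒dyck , rho-injective , rho-surjective
  where open Trees I j J I-sorted J-sorted I≢[] min∈I max∈J

proposition3p3 : ((I J : List ℕ) → Linked _<_ I → Linked _<_ J → I ≢ [] → J ≢ [] →
    (∃[ i ] (i ∈ I × (∀ j → j ∈ J → i ≤ j))) →
    (∃[ j ] (j ∈ J × (∀ i → i ∈ I → i ≤ j))) →
    (∀ T → IsTree I J T → IsDyck (nuPath I J) (rho I J T))
    × (∀ T T' → IsTree I J T → IsTree I J T' → rho I J T ≡ rho I J T' → T ≡ T')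
    × (∀ π → IsDyck (nuPath I J) π → ∃[ T ] (IsTree I J T × rho I J T ≡ π)))
    × ((ν : LatticePath) → ∃[ I ] ∃[ J ] (Linked _<_ I × Linked _<_ J
    × (∀ n → n ∈ I → n ∈ J → ⊥)
    × (∀ n → (n ∈ I ⊎ n ∈ J) → n ≤ suc (length ν))
    × (∀ n → n ≤ suc (length ν) → n ∈ I ⊎ n ∈ J)
    × nuPath I J ≡ ν))
proposition3p3 = rho-bijection , nuPath-surjective
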